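{- Let $\Delta$ be a $(d-1)$-dimensional Boolean cell complex whose $h$-vector is reciprocal, i.e. $h_i^\Delta = h_{d-i}^\Delta$ for $0 \le i \le d$. Then $\mathrm{sd}(\Delta)$ also has reciprocal $h$-vector, i.e. $h_i^{\mathrm{sd}(\Delta)} = h_{d-i}^{\mathrm{sd}(\Delta)}$ for $0 \le i \le d$.
   Context: A Boolean cell complex is a regular CW-complex $\Delta$, regarded as the poset of its cells (faces) ordered by closure containment, with the empty cell included as least element, such that every lower interval $[\emptyset, A]$ is a Boolean lattice. For a $(d-1)$-dimensional Boolean cell complex, $f_{i}^\Delta$ ($-1 \le i \le d-1$) is the number of $i$-dimensional faces ($f_{ -1}^\Delta=1$), and the $h$-vector is defined by $\sum_{i=0}^d h_i^\Delta t^{d-i} = \sum_{i=0}^d f_{i-1}^\Delta (t-1)^{d-i}$. The barycentric subdivision $\mathrm{sd}(\Delta)$ is the simplicial complex whose vertices are the non-empty faces of $\Delta$ and whose faces are strictly increasing chains of non-empty faces; it has dimension $d-1$. -}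

module Defs where

open import Data.Nat using (ℕ; zero; suc; _∸_; _≤_)
open import Data.Integer as ℤ using (ℤ; +_; -_)
open import Data.Bool using (Bool; true; false; _∧_; _∨_; not)
open import Data.Fin using (Fin)
open import Data.Fin.Properties using (_≟_)
open import Data.Fin.Subset using (Subset; _⊆_)
open import Data.List as L using (List; []; _∷_; length; filterᵇ; allFin; upTo; concatMap)
open import Data.Vec using (Vec; []; _∷_)
open import Data.Product using (Σ; ∃; ∃-syntax; _×_)
open import Function.Bundles using (_⇔_)
open import Relation.Nullary using (does)
open import Relation.Binary.Structures using (IsDecPartialOrder)
open import Relation.Binary.PropositionalEquality using (_≡_)

-- Faces are the elements of Fin n; the empty face is `bot`, the least
-- element; every lower interval [bot, A] is order-isomorphic to the
-- Boolean lattice of subsets of some finite set Fin k (under ⊆).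

record BooleanCellComplex : Set₁ where
  field
    n       : ℕ
    _≼_     : Fin n → Fin n → Set
    isDPO   : IsDecPartialOrder _≡_ _≼_
    bot     : Fin n
    bot-least : ∀ A → bot ≼ A
    boolean : ∀ A → ∃[ k ] Σ (Subset k → Fin n) λ φ →
                (∀ S → φ S ≼ A)
              × (∀ B → B ≼ A → ∃[ S ] φ S ≡ B)
              × (∀ S T → (S ⊆ T) ⇔ (φ S ≼ φ T))

  open IsDecPartialOrder isDPO public using (_≤?_)

  _≼ᵇ_ : Fin n → Fin n → Bool
  A ≼ᵇ B = does (A ≤? B)

  _≡ᵇ_ : Fin n → Fin n → Bool
  A ≡ᵇ B = does (A ≟ B)

  _≺ᵇ_ : Fin n → Fin n → Bool
  A ≺ᵇ B = (A ≼ᵇ B) ∧ not (A ≡ᵇ B)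

  nonemptyᵇ : Fin n → Bool
  nonemptyᵇ A = not (A ≡ᵇ bot)

  atomᵇ : Fin n → Bool
  atomᵇ B = nonemptyᵇ B ∧ L.foldr _∧_ true (L.map (λ C → not (C ≼ᵇ B) ∨ (C ≡ᵇ bot) ∨ (C ≡ᵇ B)) (allFin n))

  -- rank A = number of atoms below A  (= k with [∅,A] Boolean of rank k);
  -- dim A = rank A - 1
  rank : Fin n → ℕ
  rank A = length (filterᵇ (λ B → atomᵇ B ∧ (B ≼ᵇ A)) (allFin n))

  -- f i = f_{i-1}^Δ = number of faces of dimension i-1 (i.e. of rank i)
  f : ℕ → ℕ
  f i = length (filterᵇ (λ A → does (rank A Data.Nat.≟ i)) (allFin n))

  -- Δ is (d-1)-dimensional: all faces have rank ≤ d and some face has rank d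
  HasDim : ℕ → Set
  HasDim d = (∀ A → rank A ≤ d) × ∃[ A ] rank A ≡ d

  -- barycentric subdivision: its (j-1)-dimensional faces are the strictly
  -- increasing chains A₁ < ⋯ < Aⱼ of non-empty faces of Δ
  chainᵇ : ∀ {j} → Vec (Fin n) j → Bool
  chainᵇ [] = true
  chainᵇ (a ∷ []) = nonemptyᵇ a
  chainᵇ (a ∷ b ∷ r) = nonemptyᵇ a ∧ (a ≺ᵇ b) ∧ chainᵇ (b ∷ r)

  allVecs : (j : ℕ) → List (Vec (Fin n) j)
  allVecs zero = [] ∷ []
  allVecs (suc j) = concatMap (λ x → L.map (x ∷_) (allVecs j)) (allFin n)

  -- fsd j = f_{j-1}^{sd(Δ)}
  fsd : ℕ → ℕ
  fsd j = length (filterᵇ chainᵇ (allVecs j))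

-- Polynomials over ℤ as coefficient lists (index i = coefficient of t^i)

Poly : Set
Poly = List ℤ

_+ₚ_ : Poly → Poly → Poly
[] +ₚ q = q
(a ∷ p) +ₚ [] = a ∷ p
(a ∷ p) +ₚ (b ∷ q) = (a ℤ.+ b) ∷ (p +ₚ q)

scale : ℤ → Poly → Poly
scale c = L.map (c ℤ.*_)

mulTminus1 : Poly → Poly
mulTminus1 p = ((+ 0) ∷ p) +ₚ scale (- (+ 1)) p

tMinus1^ : ℕ → Poly
tMinus1^ zero = (+ 1) ∷ []
tMinus1^ (suc m) = mulTminus1 (tMinus1^ m)

coeff : Poly → ℕ → ℤ
coeff [] _ = + 0
coeff (a ∷ p) zero = a
coeff (a ∷ p) (suc i) = coeff p i

-- h-vector from f-vector (f i = f_{i-1}) in dimension d-1: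
--   Σ_{i=0}^d h_i t^{d-i} = Σ_{i=0}^d f_{i-1} (t-1)^{d-i}
fPoly : ℕ → (ℕ → ℕ) → Poly
fPoly d f = L.foldr _+ₚ_ [] (L.map (λ i → scale (+ f i) (tMinus1^ (d ∸ i))) (upTo (suc d)))

hVec : ℕ → (ℕ → ℕ) → ℕ → ℤ
hVec d f i = coeff (fPoly d f) (d ∸ i)

Reciprocal : ℕ → (ℕ → ℤ) → Set
Reciprocal d h = ∀ i → i ≤ d → h i ≡ h (d ∸ i)

-- Write f_r for the number of faces of rank r. Counting the chains of j non-empty faces by
-- their top face gives f^sd_j = Σ_r f_r · surj(r, j): below a face of rank r the face poset
-- is a Boolean lattice, whose chains of j non-empty elements ending at the top correspond to
-- the surjections of an r-set onto a j-set. Reversing the h-vector corresponds to the transform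
-- f_j ↦ Σ_k (-1)^(d+k) C(k, j) f_k of the f-vector, and the h-matrix is unitriangular, so a
-- reciprocal h-vector is the same as a fixed point of this transform (Dehn–Sommerville).
-- The identity Σ_m (-1)^(k+m) C(m, j) surj(k, m) = Σ_p C(k, p) surj(p, j) makes the transform
-- commute with f ↦ Σ_r f_r surj(r, ·), so fixed points are carried to fixed points.

module Submission where

open import Defs
open import Data.Nat using (ℕ)
open BooleanCellComplex using (f; fsd; HasDim)

open import Data.Nat as ℕ using (zero; suc; _∸_; z≤n; s≤s)
import Data.Nat.Properties as ℕP
open import Data.Nat.Induction using (<-rec)
open import Data.Integer using (ℤ; +_; -_; _+_; _*_; _-_)
import Data.Integer.Properties as ℤP
open import Data.Integer.Tactic.RingSolver using (solve-∀)
open import Algebra.Bundles using (AbelianGroup)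
open import Algebra.Properties.Semiring.Sum ℤP.+-*-semiring using (sum; sum-cong-≗; sum-replicate-zero; ∑-distrib-+; ∑-comm; *-distribˡ-sum; *-distribʳ-sum)
open import Algebra.Properties.Group (AbelianGroup.group ℤP.+-0-abelianGroup) using (∙-cancelʳ)
open import Data.Bool using (Bool; true; false; _∧_; _∨_; not)
import Data.Bool.Properties as BoolP
open import Data.Bool.ListAction using (and)
open import Data.Fin using (Fin; zero; suc; toℕ)
import Data.Fin.Properties as FinP
open import Data.Fin.Subset using (Subset; _⊆_; ⊥; ⊤; ∁; ∣_∣)
open import Data.Fin.Subset.Properties using (_⊆?_; ⊆-refl; ⊆-antisym; ⊆-min; ⊆⊤; ∣⊥∣≡0; ∣∁p∣≡n∸∣p∣)
open import Data.List as L using (List; []; _∷_; _++_; length; filterᵇ)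
open import Data.List.Properties using (map-tabulate)
open import Data.Vec using (Vec; []; _∷_)
open import Data.Vec.Properties using (≡-dec)
open import Data.Product using (_,_; _×_; proj₁; proj₂; ∃)
open import Data.Sum using (inj₁; inj₂)
open import Function using (_∘_)
open import Function.Bundles using (Equivalence; _⇔_; mk⇔)
open import Relation.Nullary using (does; yes; no; ¬_; contradiction)
open import Relation.Nullary.Decidable using (dec-true; dec-false)
open import Relation.Binary.Definitions using (tri<; tri≈; tri>; DecidableEquality)
open import Relation.Binary.Structures using (IsDecPartialOrder)
open import Relation.Binary.PropositionalEquality using (_≡_; refl; sym; trans; cong; cong₂; subst; module ≡-Reasoning)

-- Finite sums

𝟙 : Bool → ℤ
𝟙 true = + 1
𝟙 false = + 0

𝟙-∧ : ∀ a b → 𝟙 (a ∧ b) ≡ 𝟙 a * 𝟙 b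
𝟙-∧ true true = refl
𝟙-∧ true false = refl
𝟙-∧ false b = refl

sum-zero : ∀ {n} {F : Fin n → ℤ} → (∀ i → F i ≡ + 0) → sum F ≡ + 0
sum-zero {n} F≗0 = trans (sum-cong-≗ F≗0) (sum-replicate-zero n)

sum-commute : ∀ {B : Set} (S : (B → ℤ) → ℤ) →
  (∀ F G → S (λ b → F b + G b) ≡ S F + S G) → S (λ _ → + 0) ≡ + 0 →
  ∀ {n} (F : Fin n → B → ℤ) → sum (λ i → S (F i)) ≡ S (λ b → sum (λ i → F i b))
sum-commute S S-+ S-0 {zero} F = sym S-0
sum-commute S S-+ S-0 {suc n} F =
  trans (cong (λ z → S (F zero) + z) (sum-commute S S-+ S-0 (F ∘ suc))) (sym (S-+ _ _))

sum-δ : ∀ {n} (z : Fin n) (G : Fin n → ℤ) → sum (λ y → 𝟙 (does (z FinP.≟ y)) * G y) ≡ G z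
sum-δ {suc n} zero G =
  trans (cong (λ z → + 1 * G zero + z) (sum-zero {n} (λ _ → refl))) (trans (ℤP.+-identityʳ _) (ℤP.*-identityˡ _))
sum-δ (suc z) G = trans (ℤP.+-identityˡ _) (sum-δ z (G ∘ suc))

∑ : (n : ℕ) → (ℕ → ℤ) → ℤ
∑ n F = sum {n} (F ∘ toℕ)

∑-cong : ∀ n {F G : ℕ → ℤ} → (∀ i → i ℕ.< n → F i ≡ G i) → ∑ n F ≡ ∑ n G
∑-cong n e = sum-cong-≗ (λ i → e (toℕ i) (FinP.toℕ<n i))

∑-zero : ∀ n {F : ℕ → ℤ} → (∀ i → i ℕ.< n → F i ≡ + 0) → ∑ n F ≡ + 0
∑-zero n e = sum-zero (λ i → e (toℕ i) (FinP.toℕ<n i))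

∑-+ : ∀ n (F G : ℕ → ℤ) → ∑ n (λ i → F i + G i) ≡ ∑ n F + ∑ n G
∑-+ n F G = ∑-distrib-+ {n} (F ∘ toℕ) (G ∘ toℕ)

∑-*ˡ : ∀ n c (F : ℕ → ℤ) → ∑ n (λ i → c * F i) ≡ c * ∑ n F
∑-*ˡ n c F = sym (*-distribˡ-sum {n} c (F ∘ toℕ))

∑-neg : ∀ n (F : ℕ → ℤ) → ∑ n (λ i → - F i) ≡ - ∑ n F
∑-neg n F = trans (∑-cong n (λ i _ → sym (ℤP.-1*i≡-i (F i)))) (trans (∑-*ˡ n (- + 1) F) (ℤP.-1*i≡-i _))

∑-- : ∀ n (F G : ℕ → ℤ) → ∑ n (λ i → F i - G i) ≡ ∑ n F - ∑ n G
∑-- n F G = trans (∑-+ n F (λ i → - G i)) (cong (λ z → ∑ n F + z) (∑-neg n G))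

∑-swap : ∀ n m (F : ℕ → ℕ → ℤ) → ∑ n (λ i → ∑ m (F i)) ≡ ∑ m (λ j → ∑ n (λ i → F i j))
∑-swap n m F = ∑-comm {n} {m} (λ i j → F (toℕ i) (toℕ j))

∑-suc : ∀ n (F : ℕ → ℤ) → ∑ (suc n) F ≡ ∑ n F + F n
∑-suc zero F = trans (ℤP.+-identityʳ (F 0)) (sym (ℤP.+-identityˡ (F 0)))
∑-suc (suc n) F = trans (cong (λ z → F 0 + z) (∑-suc n (F ∘ suc))) (sym (ℤP.+-assoc (F 0) _ _))

∑-vanishing-tail : ∀ n m (F : ℕ → ℤ) → n ℕ.≤ m → (∀ i → n ℕ.≤ i → F i ≡ + 0) → ∑ m F ≡ ∑ n F
∑-vanishing-tail zero m F _ e = ∑-zero m (λ i _ → e i z≤n)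
∑-vanishing-tail (suc n) (suc m) F (s≤s n≤m) e =
  cong (λ z → F 0 + z) (∑-vanishing-tail n m (F ∘ suc) n≤m (λ i n≤i → e (suc i) (s≤s n≤i)))

∑-shift : ∀ n (F : ℕ → ℤ) → F 0 ≡ + 0 → F n ≡ + 0 → ∑ n (F ∘ suc) ≡ ∑ n F
∑-shift n F F0≡0 Fn≡0 = begin
    ∑ n (F ∘ suc)                ≡⟨ sym (ℤP.+-identityˡ _) ⟩
    + 0 + ∑ n (F ∘ suc)          ≡⟨ cong (λ z → z + ∑ n (F ∘ suc)) (sym F0≡0) ⟩
    ∑ (suc n) F                  ≡⟨ ∑-suc n F ⟩
    ∑ n F + F n                  ≡⟨ cong (λ z → ∑ n F + z) Fn≡0 ⟩
    ∑ n F + + 0                  ≡⟨ ℤP.+-identityʳ _ ⟩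
    ∑ n F                        ∎
  where open ≡-Reasoning

∑-δ : ∀ n r (G : ℕ → ℤ) → r ℕ.< n → ∑ n (λ k → 𝟙 (does (r ℕ.≟ k)) * G k) ≡ G r
∑-δ (suc n) zero G _ =
  trans (cong (λ z → + 1 * G 0 + z) (∑-zero n (λ _ _ → refl))) (trans (ℤP.+-identityʳ _) (ℤP.*-identityˡ _))
∑-δ (suc n) (suc r) G (s≤s r<n) = trans (ℤP.+-identityˡ _) (∑-δ n r (G ∘ suc) r<n)

∑List : ∀ {A : Set} → List A → (A → ℤ) → ℤ
∑List [] F = + 0
∑List (x ∷ xs) F = F x + ∑List xs F

∑List-cong : ∀ {A : Set} (xs : List A) {F G : A → ℤ} → (∀ x → F x ≡ G x) → ∑List xs F ≡ ∑List xs G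
∑List-cong [] e = refl
∑List-cong (x ∷ xs) e = cong₂ _+_ (e x) (∑List-cong xs e)

∑List-*ˡ : ∀ {A : Set} (xs : List A) c (F : A → ℤ) → ∑List xs (λ x → c * F x) ≡ c * ∑List xs F
∑List-*ˡ [] c F = sym (ℤP.*-zeroʳ c)
∑List-*ˡ (x ∷ xs) c F = trans (cong (λ z → c * F x + z) (∑List-*ˡ xs c F)) (sym (ℤP.*-distribˡ-+ c (F x) _))

∑List-++ : ∀ {A : Set} (xs ys : List A) F → ∑List (xs ++ ys) F ≡ ∑List xs F + ∑List ys F
∑List-++ [] ys F = sym (ℤP.+-identityˡ _)
∑List-++ (x ∷ xs) ys F = trans (cong (λ z → F x + z) (∑List-++ xs ys F)) (sym (ℤP.+-assoc (F x) _ _))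

∑List-map : ∀ {A B : Set} (g : A → B) (xs : List A) F → ∑List (L.map g xs) F ≡ ∑List xs (F ∘ g)
∑List-map g [] F = refl
∑List-map g (x ∷ xs) F = cong (λ z → F (g x) + z) (∑List-map g xs F)

∑List-concatMap : ∀ {A B : Set} (g : A → List B) (xs : List A) F →
  ∑List (L.concatMap g xs) F ≡ ∑List xs (λ x → ∑List (g x) F)
∑List-concatMap g [] F = refl
∑List-concatMap g (x ∷ xs) F = trans (∑List-++ (g x) _ F) (cong (λ z → ∑List (g x) F + z) (∑List-concatMap g xs F))

∑List-tabulate : ∀ {A : Set} n (g : Fin n → A) F → ∑List (L.tabulate g) F ≡ sum (F ∘ g)
∑List-tabulate zero g F = refl
∑List-tabulate (suc n) g F = cong (λ z → F (g zero) + z) (∑List-tabulate n (g ∘ suc) F)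

∑List-applyUpTo : ∀ {A : Set} n (g : ℕ → A) F → ∑List (L.applyUpTo g n) F ≡ ∑ n (F ∘ g)
∑List-applyUpTo zero g F = refl
∑List-applyUpTo (suc n) g F = cong (λ z → F (g 0) + z) (∑List-applyUpTo n (g ∘ suc) F)

length-filterᵇ : ∀ {A : Set} (p : A → Bool) (xs : List A) → + length (filterᵇ p xs) ≡ ∑List xs (𝟙 ∘ p)
length-filterᵇ p [] = refl
length-filterᵇ p (x ∷ xs) with p x
... | true = cong (λ z → + 1 + z) (length-filterᵇ p xs)
... | false = trans (length-filterᵇ p xs) (sym (ℤP.+-identityˡ _))

-- Signs, binomial coefficients and surjection numbers

-1^ : ℕ → ℤ
-1^ zero = + 1
-1^ (suc n) = - -1^ n

-1^-+ : ∀ m n → -1^ (m ℕ.+ n) ≡ -1^ m * -1^ n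
-1^-+ zero n = sym (ℤP.*-identityˡ _)
-1^-+ (suc m) n = trans (cong -_ (-1^-+ m n)) (ℤP.neg-distribˡ-* (-1^ m) (-1^ n))

-1^-+-suc : ∀ m n → -1^ (m ℕ.+ suc n) ≡ - -1^ (m ℕ.+ n)
-1^-+-suc m n = cong -1^ (ℕP.+-suc m n)

-1^-suc-+-suc : ∀ m n → -1^ (suc m ℕ.+ suc n) ≡ -1^ (m ℕ.+ n)
-1^-suc-+-suc m n = trans (cong -_ (-1^-+-suc m n)) (ℤP.neg-involutive _)

-1^-square : ∀ n → -1^ n * -1^ n ≡ + 1
-1^-square zero = refl
-1^-square (suc n) = trans (neg-square (-1^ n)) (-1^-square n)
  where
  neg-square : ∀ a → (- a) * (- a) ≡ a * a
  neg-square = solve-∀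

-1^-∸ : ∀ d j → j ℕ.≤ d → -1^ (d ∸ j) ≡ -1^ d * -1^ j
-1^-∸ d zero _ = sym (ℤP.*-identityʳ _)
-1^-∸ (suc d) (suc j) (s≤s j≤d) = trans (-1^-∸ d j j≤d) (negate-both (-1^ d) (-1^ j))
  where
  negate-both : ∀ a b → a * b ≡ (- a) * (- b)
  negate-both = solve-∀

-1^-reindex : ∀ d i j k → i ℕ.≤ d → j ℕ.≤ d → k ℕ.≤ d →
  -1^ ((d ∸ j) ℕ.+ (d ∸ i)) * -1^ (d ℕ.+ k) ≡ -1^ ((d ∸ k) ℕ.+ i) * -1^ j
-1^-reindex d i j k i≤d j≤d k≤d = begin
  -1^ ((d ∸ j) ℕ.+ (d ∸ i)) * -1^ (d ℕ.+ k)
    ≡⟨ cong₂ _*_ (trans (-1^-+ (d ∸ j) (d ∸ i)) (cong₂ _*_ (-1^-∸ d j j≤d) (-1^-∸ d i i≤d))) (-1^-+ d k) ⟩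
  (-1^ d * -1^ j) * (-1^ d * -1^ i) * (-1^ d * -1^ k)
    ≡⟨ regroup (-1^ d) (-1^ j) (-1^ i) (-1^ k) ⟩
  (-1^ d * -1^ d) * ((-1^ d * -1^ k) * -1^ i * -1^ j)
    ≡⟨ cong (_* ((-1^ d * -1^ k) * -1^ i * -1^ j)) (-1^-square d) ⟩
  + 1 * ((-1^ d * -1^ k) * -1^ i * -1^ j)
    ≡⟨ ℤP.*-identityˡ _ ⟩
  (-1^ d * -1^ k) * -1^ i * -1^ j
    ≡⟨ cong (λ t → t * -1^ i * -1^ j) (sym (-1^-∸ d k k≤d)) ⟩
  -1^ (d ∸ k) * -1^ i * -1^ j
    ≡⟨ cong (_* -1^ j) (sym (-1^-+ (d ∸ k) i)) ⟩
  -1^ ((d ∸ k) ℕ.+ i) * -1^ j ∎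
  where
  open ≡-Reasoning
  regroup : ∀ sd sj si sk → (sd * sj) * (sd * si) * (sd * sk) ≡ (sd * sd) * ((sd * sk) * si * sj)
  regroup = solve-∀

binom : ℕ → ℕ → ℤ
binom n zero = + 1
binom zero (suc k) = + 0
binom (suc n) (suc k) = binom n k + binom n (suc k)

binom-vanishes : ∀ n k → n ℕ.< k → binom n k ≡ + 0
binom-vanishes zero (suc k) _ = refl
binom-vanishes (suc n) (suc k) (s≤s n<k) =
  cong₂ _+_ (binom-vanishes n k n<k) (binom-vanishes n (suc k) (ℕP.m<n⇒m<1+n n<k))

binom-vanishing-tail : ∀ {k m} → k ℕ.≤ m → (G : ℕ → ℤ) →
  ∑ (suc m) (λ p → binom k p * G p) ≡ ∑ (suc k) (λ p → binom k p * G p)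
binom-vanishing-tail {k} {m} k≤m G = ∑-vanishing-tail (suc k) (suc m) (λ p → binom k p * G p) (s≤s k≤m)
  (λ p k<p → trans (cong (_* G p) (binom-vanishes k p k<p)) (ℤP.*-zeroˡ (G p)))

binom-diag : ∀ n → binom n n ≡ + 1
binom-diag zero = refl
binom-diag (suc n) = cong₂ _+_ (binom-diag n) (binom-vanishes n (suc n) (ℕP.n<1+n n))

binom-absorption : ∀ m j → + suc j * binom m (suc j) + + j * binom m j ≡ + m * binom m j
binom-absorption zero zero = refl
binom-absorption zero (suc j) = zeros (+ suc (suc j)) (+ suc j)
  where
  zeros : ∀ a b → a * + 0 + b * + 0 ≡ + 0 * + 0
  zeros = solve-∀
binom-absorption (suc m) zero = begin
    + 1 * (+ 1 + y) + + 0 * + 1   ≡⟨ shuffle y ⟩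
    + 1 + (+ 1 * y + + 0 * + 1)   ≡⟨ cong (λ z → + 1 + z) (binom-absorption m zero) ⟩
    + 1 + + m * + 1               ≡⟨ cong (λ z → + 1 + z) (ℤP.*-identityʳ (+ m)) ⟩
    + suc m                       ≡⟨ sym (ℤP.*-identityʳ (+ suc m)) ⟩
    + suc m * + 1                 ∎
  where
  open ≡-Reasoning
  y = binom m 1
  shuffle : ∀ y → + 1 * (+ 1 + y) + + 0 * + 1 ≡ + 1 + (+ 1 * y + + 0 * + 1)
  shuffle = solve-∀
binom-absorption (suc m) (suc j) = begin
    (+ 1 + (+ 1 + J)) * (y + z) + (+ 1 + J) * (x + y)
      ≡⟨ split J x y z ⟩
    ((+ 1 + (+ 1 + J)) * z + (+ 1 + J) * y) + ((+ 1 + J) * y + J * x) + (x + y)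
      ≡⟨ cong₂ (λ a b → a + b + (x + y)) (binom-absorption m (suc j)) (binom-absorption m j) ⟩
    M * y + M * x + (x + y)
      ≡⟨ merge M x y ⟩
    (+ 1 + M) * (x + y) ∎
  where
  open ≡-Reasoning
  J = + j
  M = + m
  x = binom m j
  y = binom m (suc j)
  z = binom m (suc (suc j))
  split : ∀ J x y z → (+ 1 + (+ 1 + J)) * (y + z) + (+ 1 + J) * (x + y) ≡
                      ((+ 1 + (+ 1 + J)) * z + (+ 1 + J) * y) + ((+ 1 + J) * y + J * x) + (x + y)
  split = solve-∀
  merge : ∀ M x y → M * y + M * x + (x + y) ≡ (+ 1 + M) * (x + y)
  merge = solve-∀

binom-complement : ∀ n i → i ℕ.≤ n → binom n (n ∸ i) ≡ binom n i
binom-complement zero zero _ = refl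
binom-complement (suc n) zero _ = binom-diag (suc n)
binom-complement (suc n) (suc i) (s≤s i≤n) with ℕP.m≤n⇒m<n∨m≡n i≤n
... | inj₂ refl = trans (cong (binom (suc n)) (ℕP.n∸n≡0 i)) (sym (binom-diag (suc i)))
... | inj₁ i<n = begin
    binom (suc n) (n ∸ i)                         ≡⟨ cong (binom (suc n)) (∸-suc i<n) ⟩
    binom n (n ∸ suc i) + binom n (suc (n ∸ suc i)) ≡⟨ cong₂ _+_ (binom-complement n (suc i) i<n)
                                                               (cong (binom n) (sym (∸-suc i<n))) ⟩
    binom n (suc i) + binom n (n ∸ i)             ≡⟨ cong (λ z → binom n (suc i) + z) (binom-complement n i i≤n) ⟩
    binom n (suc i) + binom n i                   ≡⟨ ℤP.+-comm (binom n (suc i)) (binom n i) ⟩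
    binom n i + binom n (suc i)                   ∎
  where
  open ≡-Reasoning
  ∸-suc : ∀ {n i} → i ℕ.< n → n ∸ i ≡ suc (n ∸ suc i)
  ∸-suc {n} {i} i<n = ℕP.+-∸-assoc 1 i<n

surj : ℕ → ℕ → ℤ
surj zero zero = + 1
surj zero (suc m) = + 0
surj (suc k) zero = + 0
surj (suc k) (suc m) = + suc m * (surj k (suc m) + surj k m)

surj-vanishes : ∀ k m → k ℕ.< m → surj k m ≡ + 0
surj-vanishes zero (suc m) _ = refl
surj-vanishes (suc k) (suc m) (s≤s k<m) =
  trans (cong (+ suc m *_) (cong₂ _+_ (surj-vanishes k (suc m) (ℕP.m<n⇒m<1+n k<m)) (surj-vanishes k m k<m)))
        (ℤP.*-zeroʳ (+ suc m))

surj⁺ : ℕ → ℕ → ℤ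
surj⁺ k j = surj k j + surj k (suc j)

record SurjRecurrence (R : ℕ → ℕ → ℤ) : Set where
  field
    initial-zero : R 0 0 ≡ + 1
    initial-suc  : ∀ j → R 0 (suc j) ≡ + 0
    step-zero    : ∀ k → R (suc k) 0 ≡ R k 0
    step-suc     : ∀ k j → R (suc k) (suc j) ≡ + suc (suc j) * R k (suc j) + + suc j * R k j

surj⁺-recurrence : SurjRecurrence surj⁺
surj⁺-recurrence = record
  { initial-zero = refl
  ; initial-suc  = λ _ → refl
  ; step-zero    = λ k → swap-zero (surj k 1) (surj k 0)
  ; step-suc     = λ k j → regroup (+ suc j) (surj k j) (surj k (suc j)) (surj k (suc (suc j)))
  }
  where
  swap-zero : ∀ a b → + 0 + + 1 * (a + b) ≡ b + a
  swap-zero = solve-∀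
  regroup : ∀ J x y z → J * (y + x) + (+ 1 + J) * (z + y) ≡ (+ 1 + J) * (y + z) + J * (x + y)
  regroup = solve-∀

SurjRecurrence⇒≡surj⁺ : ∀ {R} → SurjRecurrence R → ∀ k j → R k j ≡ surj⁺ k j
SurjRecurrence⇒≡surj⁺ rec zero zero = SurjRecurrence.initial-zero rec
SurjRecurrence⇒≡surj⁺ rec zero (suc j) = SurjRecurrence.initial-suc rec j
SurjRecurrence⇒≡surj⁺ rec (suc k) zero =
  trans (SurjRecurrence.step-zero rec k)
        (trans (SurjRecurrence⇒≡surj⁺ rec k 0) (sym (SurjRecurrence.step-zero surj⁺-recurrence k)))
SurjRecurrence⇒≡surj⁺ rec (suc k) (suc j) =
  trans (SurjRecurrence.step-suc rec k j)
        (trans (cong₂ (λ x y → + suc (suc j) * x + + suc j * y)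
                      (SurjRecurrence⇒≡surj⁺ rec k (suc j)) (SurjRecurrence⇒≡surj⁺ rec k j))
               (sym (SurjRecurrence.step-suc surj⁺-recurrence k j)))

∑-pascal : ∀ k (G : ℕ → ℤ) →
  ∑ (suc (suc k)) (λ p → binom (suc k) p * G p) ≡ ∑ (suc k) (λ p → binom k p * (G p + G (suc p)))
∑-pascal k G = begin
    + 1 * G 0 + ∑ (suc k) (λ p → (binom k p + binom k (suc p)) * G (suc p))
      ≡⟨ cong (λ z → + 1 * G 0 + z) (trans (∑-cong (suc k) (λ p _ → ℤP.*-distribʳ-+ (G (suc p)) (binom k p) (binom k (suc p))))
                                           (∑-+ (suc k) (λ p → binom k p * G (suc p)) (λ p → binom k (suc p) * G (suc p)))) ⟩
    + 1 * G 0 + (X + Y)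
      ≡⟨ rotate (+ 1 * G 0) X Y ⟩
    (+ 1 * G 0 + Y) + X
      ≡⟨ cong (_+ X) (sym head+Y) ⟩
    ∑ (suc k) (λ p → binom k p * G p) + X
      ≡⟨ sym (∑-+ (suc k) (λ p → binom k p * G p) (λ p → binom k p * G (suc p))) ⟩
    ∑ (suc k) (λ p → binom k p * G p + binom k p * G (suc p))
      ≡⟨ ∑-cong (suc k) (λ p _ → sym (ℤP.*-distribˡ-+ (binom k p) (G p) (G (suc p)))) ⟩
    ∑ (suc k) (λ p → binom k p * (G p + G (suc p))) ∎
  where
  open ≡-Reasoning
  X = ∑ (suc k) (λ p → binom k p * G (suc p))
  Y = ∑ (suc k) (λ p → binom k (suc p) * G (suc p))
  rotate : ∀ a x y → a + (x + y) ≡ a + y + x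
  rotate = solve-∀
  head+Y : ∑ (suc k) (λ p → binom k p * G p) ≡ + 1 * G 0 + Y
  head+Y = sym (binom-vanishing-tail (ℕP.n≤1+n k) G)

∑-binom-surj : ∀ k j → ∑ (suc k) (λ p → binom k p * surj p j) ≡ surj⁺ k j
∑-binom-surj = SurjRecurrence⇒≡surj⁺ (record
  { initial-zero = refl
  ; initial-suc  = λ _ → refl
  ; step-zero    = λ k → trans (∑-pascal k (λ p → surj p 0))
                               (∑-cong (suc k) (λ p _ → cong (binom k p *_) (ℤP.+-identityʳ (surj p 0))))
  ; step-suc     = step-suc
  })
  where
  U : ℕ → ℕ → ℤ
  U k j = ∑ (suc k) (λ p → binom k p * surj p j)
  distribute : ∀ b x y J → b * (y + (+ 1 + J) * (y + x)) ≡ (+ 1 + (+ 1 + J)) * (b * y) + (+ 1 + J) * (b * x)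
  distribute = solve-∀
  step-suc : ∀ k j → U (suc k) (suc j) ≡ + suc (suc j) * U k (suc j) + + suc j * U k j
  step-suc k j = begin
    U (suc k) (suc j)
      ≡⟨ ∑-pascal k (λ p → surj p (suc j)) ⟩
    ∑ (suc k) (λ p → binom k p * (surj p (suc j) + surj (suc p) (suc j)))
      ≡⟨ ∑-cong (suc k) (λ p _ → distribute (binom k p) (surj p j) (surj p (suc j)) (+ j)) ⟩
    ∑ (suc k) (λ p → + suc (suc j) * (binom k p * surj p (suc j)) + + suc j * (binom k p * surj p j))
      ≡⟨ ∑-+ (suc k) (λ p → + suc (suc j) * (binom k p * surj p (suc j))) (λ p → + suc j * (binom k p * surj p j)) ⟩
    ∑ (suc k) (λ p → + suc (suc j) * (binom k p * surj p (suc j))) + ∑ (suc k) (λ p → + suc j * (binom k p * surj p j))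
      ≡⟨ cong₂ _+_ (∑-*ˡ (suc k) (+ suc (suc j)) (λ p → binom k p * surj p (suc j)))
                   (∑-*ˡ (suc k) (+ suc j) (λ p → binom k p * surj p j)) ⟩
    + suc (suc j) * U k (suc j) + + suc j * U k j ∎
    where open ≡-Reasoning

binomDiff : ℕ → ℕ → ℤ
binomDiff m j = binom (suc m) j * + suc m - binom m j * + m

binomDiff-zero : ∀ m → binomDiff m 0 ≡ + 1
binomDiff-zero m = cancel (+ m)
  where
  cancel : ∀ M → + 1 * (+ 1 + M) - + 1 * M ≡ + 1
  cancel = solve-∀

binomDiff-suc : ∀ m j → binomDiff m (suc j) ≡ + suc (suc j) * binom m (suc j) + + suc j * binom m j
binomDiff-suc m j = begin
    (x + y) * (+ 1 + M) - y * M          ≡⟨ expand x y M ⟩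
    x + y + M * x                        ≡⟨ cong (λ w → x + y + w) (sym (binom-absorption m j)) ⟩
    x + y + ((+ 1 + J) * y + J * x)      ≡⟨ collect x y J ⟩
    (+ 1 + (+ 1 + J)) * y + (+ 1 + J) * x ∎
  where
  open ≡-Reasoning
  J = + j
  M = + m
  x = binom m j
  y = binom m (suc j)
  expand : ∀ x y M → (x + y) * (+ 1 + M) - y * M ≡ x + y + M * x
  expand = solve-∀
  collect : ∀ x y J → x + y + ((+ 1 + J) * y + J * x) ≡ (+ 1 + (+ 1 + J)) * y + (+ 1 + J) * x
  collect = solve-∀

alternatingSurj : ℕ → ℕ → ℤ
alternatingSurj k j = ∑ (suc k) (λ m → -1^ (k ℕ.+ m) * (binom m j * surj k m))

alternatingSurj-suc : ∀ k j →
  alternatingSurj (suc k) j ≡ ∑ (suc k) (λ m → -1^ (k ℕ.+ m) * surj k m * binomDiff m j)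
alternatingSurj-suc k j = begin
    -1^ (suc k ℕ.+ 0) * (binom 0 j * + 0) +
    ∑ (suc k) (λ m → -1^ (suc k ℕ.+ suc m) * (binom (suc m) j * surj (suc k) (suc m)))
      ≡⟨ cong₂ _+_ (vanish (-1^ (suc k ℕ.+ 0)) (binom 0 j)) (∑-cong (suc k) (λ m _ → split m)) ⟩
    + 0 + ∑ (suc k) (λ m → A m - Y (suc m))
      ≡⟨ ℤP.+-identityˡ _ ⟩
    ∑ (suc k) (λ m → A m - Y (suc m))
      ≡⟨ ∑-- (suc k) A (Y ∘ suc) ⟩
    ∑ (suc k) A - ∑ (suc k) (Y ∘ suc)
      ≡⟨ cong (λ w → ∑ (suc k) A - w) (∑-shift (suc k) Y Y-zero Y-top) ⟩
    ∑ (suc k) A - ∑ (suc k) Y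
      ≡⟨ sym (∑-- (suc k) A Y) ⟩
    ∑ (suc k) (λ m → A m - Y m)
      ≡⟨ ∑-cong (suc k) (λ m _ → factor (-1^ (k ℕ.+ m)) (surj k m) (binom (suc m) j) (+ suc m) (binom m j) (+ m)) ⟩
    ∑ (suc k) (λ m → -1^ (k ℕ.+ m) * surj k m * binomDiff m j) ∎
  where
  open ≡-Reasoning
  A Y : ℕ → ℤ
  A m = -1^ (k ℕ.+ m) * surj k m * (binom (suc m) j * + suc m)
  Y m = -1^ (k ℕ.+ m) * surj k m * (binom m j * + m)
  vanish : ∀ a b → a * (b * + 0) ≡ + 0
  vanish = solve-∀
  Y-zero : Y 0 ≡ + 0
  Y-zero = vanish (-1^ (k ℕ.+ 0) * surj k 0) (binom 0 j)
  Y-top : Y (suc k) ≡ + 0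
  Y-top = trans (cong (λ w → -1^ (k ℕ.+ suc k) * w * (binom (suc k) j * + suc k)) (surj-vanishes k (suc k) (ℕP.n<1+n k)))
                (zero-left (-1^ (k ℕ.+ suc k)) (binom (suc k) j * + suc k))
    where
    zero-left : ∀ s t → s * + 0 * t ≡ + 0
    zero-left = solve-∀
  split-ring : ∀ s b M1 y x → s * (b * (M1 * (y + x))) ≡ s * x * (b * M1) - (- s) * y * (b * M1)
  split-ring = solve-∀
  split : ∀ m → -1^ (suc k ℕ.+ suc m) * (binom (suc m) j * surj (suc k) (suc m)) ≡ A m - Y (suc m)
  split m = trans (split-ring (-1^ (suc k ℕ.+ suc m)) (binom (suc m) j) (+ suc m) (surj k (suc m)) (surj k m))
                  (cong₂ (λ s t → s * surj k m * (binom (suc m) j * + suc m) - t * surj k (suc m) * (binom (suc m) j * + suc m))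
                         (-1^-suc-+-suc k m)
                         (trans (cong -_ (-1^-suc-+-suc k m)) (sym (-1^-+-suc k m))))
  factor : ∀ s x b₁ M₁ b M → s * x * (b₁ * M₁) - s * x * (b * M) ≡ s * x * (b₁ * M₁ - b * M)
  factor = solve-∀

alternatingSurj≡surj⁺ : ∀ k j → alternatingSurj k j ≡ surj⁺ k j
alternatingSurj≡surj⁺ = SurjRecurrence⇒≡surj⁺ (record
  { initial-zero = refl
  ; initial-suc  = λ _ → refl
  ; step-zero    = step-zero
  ; step-suc     = step-suc
  })
  where
  step-zero : ∀ k → alternatingSurj (suc k) 0 ≡ alternatingSurj k 0
  step-zero k = trans (alternatingSurj-suc k 0) (∑-cong (suc k) λ m _ →
    trans (cong (-1^ (k ℕ.+ m) * surj k m *_) (binomDiff-zero m)) (reassoc (-1^ (k ℕ.+ m)) (surj k m)))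
    where
    reassoc : ∀ s x → s * x * + 1 ≡ s * (+ 1 * x)
    reassoc = solve-∀
  distribute : ∀ s x J₂ J₁ b₁ b₀ → s * x * (J₂ * b₁ + J₁ * b₀) ≡ J₂ * (s * (b₁ * x)) + J₁ * (s * (b₀ * x))
  distribute = solve-∀
  step-suc : ∀ k j → alternatingSurj (suc k) (suc j) ≡
                     + suc (suc j) * alternatingSurj k (suc j) + + suc j * alternatingSurj k j
  step-suc k j = begin
    alternatingSurj (suc k) (suc j)
      ≡⟨ alternatingSurj-suc k (suc j) ⟩
    ∑ (suc k) (λ m → -1^ (k ℕ.+ m) * surj k m * binomDiff m (suc j))
      ≡⟨ ∑-cong (suc k) (λ m _ → trans (cong (-1^ (k ℕ.+ m) * surj k m *_) (binomDiff-suc m j))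
                                       (distribute (-1^ (k ℕ.+ m)) (surj k m) (+ suc (suc j)) (+ suc j) (binom m (suc j)) (binom m j))) ⟩
    ∑ (suc k) (λ m → + suc (suc j) * term (suc j) m + + suc j * term j m)
      ≡⟨ ∑-+ (suc k) (λ m → + suc (suc j) * term (suc j) m) (λ m → + suc j * term j m) ⟩
    ∑ (suc k) (λ m → + suc (suc j) * term (suc j) m) + ∑ (suc k) (λ m → + suc j * term j m)
      ≡⟨ cong₂ _+_ (∑-*ˡ (suc k) (+ suc (suc j)) (term (suc j))) (∑-*ˡ (suc k) (+ suc j) (term j)) ⟩
    + suc (suc j) * alternatingSurj k (suc j) + + suc j * alternatingSurj k j ∎
    where
    open ≡-Reasoning
    term : ℕ → ℕ → ℤ
    term j m = -1^ (k ℕ.+ m) * (binom m j * surj k m)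

-- h-vectors

coeff-[] : ∀ i → coeff [] i ≡ + 0
coeff-[] zero = refl
coeff-[] (suc i) = refl

coeff-+ₚ : ∀ p q i → coeff (p +ₚ q) i ≡ coeff p i + coeff q i
coeff-+ₚ [] q i = sym (trans (cong (_+ coeff q i) (coeff-[] i)) (ℤP.+-identityˡ _))
coeff-+ₚ (a ∷ p) [] i = sym (trans (cong (λ z → coeff (a ∷ p) i + z) (coeff-[] i)) (ℤP.+-identityʳ _))
coeff-+ₚ (a ∷ p) (b ∷ q) zero = refl
coeff-+ₚ (a ∷ p) (b ∷ q) (suc i) = coeff-+ₚ p q i

coeff-scale : ∀ c p i → coeff (scale c p) i ≡ c * coeff p i
coeff-scale c [] i = trans (coeff-[] i) (sym (trans (cong (c *_) (coeff-[] i)) (ℤP.*-zeroʳ c)))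
coeff-scale c (a ∷ p) zero = refl
coeff-scale c (a ∷ p) (suc i) = coeff-scale c p i

coeff-∑ₚ : ∀ {A : Set} (g : A → Poly) (xs : List A) i →
  coeff (L.foldr _+ₚ_ [] (L.map g xs)) i ≡ ∑List xs (λ x → coeff (g x) i)
coeff-∑ₚ g [] i = coeff-[] i
coeff-∑ₚ g (x ∷ xs) i = trans (coeff-+ₚ (g x) _ i) (cong (λ z → coeff (g x) i + z) (coeff-∑ₚ g xs i))

coeff-tMinus1^ : ∀ m p → coeff (tMinus1^ m) p ≡ -1^ (m ℕ.+ p) * binom m p
coeff-tMinus1^ zero zero = refl
coeff-tMinus1^ zero (suc p) = sym (ℤP.*-zeroʳ (-1^ (suc p)))
coeff-tMinus1^ (suc m) p = begin
    coeff ((+ 0 ∷ tMinus1^ m) +ₚ scale (- + 1) (tMinus1^ m)) p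
      ≡⟨ coeff-+ₚ (+ 0 ∷ tMinus1^ m) (scale (- + 1) (tMinus1^ m)) p ⟩
    coeff (+ 0 ∷ tMinus1^ m) p + coeff (scale (- + 1) (tMinus1^ m)) p
      ≡⟨ cong (λ z → coeff (+ 0 ∷ tMinus1^ m) p + z) (trans (coeff-scale (- + 1) (tMinus1^ m) p) (ℤP.-1*i≡-i _)) ⟩
    coeff (+ 0 ∷ tMinus1^ m) p - coeff (tMinus1^ m) p
      ≡⟨ shifted p ⟩
    -1^ (suc m ℕ.+ p) * binom (suc m) p ∎
  where
  open ≡-Reasoning
  shifted : ∀ p → coeff (+ 0 ∷ tMinus1^ m) p - coeff (tMinus1^ m) p ≡ -1^ (suc m ℕ.+ p) * binom (suc m) p
  shifted zero = begin
    + 0 - coeff (tMinus1^ m) 0        ≡⟨ cong (λ z → + 0 - z) (coeff-tMinus1^ m 0) ⟩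
    + 0 - -1^ (m ℕ.+ 0) * + 1         ≡⟨ negate (-1^ (m ℕ.+ 0)) ⟩
    - -1^ (m ℕ.+ 0) * + 1             ∎
    where
    negate : ∀ s → + 0 - s * + 1 ≡ (- s) * + 1
    negate = solve-∀
  shifted (suc p) = begin
    coeff (tMinus1^ m) p - coeff (tMinus1^ m) (suc p)
      ≡⟨ cong₂ _-_ (coeff-tMinus1^ m p) (coeff-tMinus1^ m (suc p)) ⟩
    -1^ (m ℕ.+ p) * binom m p - -1^ (m ℕ.+ suc p) * binom m (suc p)
      ≡⟨ cong (λ s → -1^ (m ℕ.+ p) * binom m p - s * binom m (suc p)) (-1^-+-suc m p) ⟩
    -1^ (m ℕ.+ p) * binom m p - (- -1^ (m ℕ.+ p)) * binom m (suc p)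
      ≡⟨ pascal-signed (-1^ (m ℕ.+ p)) (binom m p) (binom m (suc p)) ⟩
    -1^ (m ℕ.+ p) * (binom m p + binom m (suc p))
      ≡⟨ cong (_* binom (suc m) (suc p)) (sym (-1^-suc-+-suc m p)) ⟩
    -1^ (suc m ℕ.+ suc p) * binom (suc m) (suc p) ∎
    where
    pascal-signed : ∀ s x y → s * x - (- s) * y ≡ s * (x + y)
    pascal-signed = solve-∀

hCoeff : ℕ → ℕ → ℕ → ℤ
hCoeff d i k = -1^ ((d ∸ k) ℕ.+ (d ∸ i)) * binom (d ∸ k) (d ∸ i)

hVector : ℕ → (ℕ → ℤ) → ℕ → ℤ
hVector d v i = ∑ (suc d) (λ k → v k * hCoeff d i k)

hVec≡hVector : ∀ d (F : ℕ → ℕ) i → hVec d F i ≡ hVector d (+_ ∘ F) i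
hVec≡hVector d F i = begin
    coeff (fPoly d F) (d ∸ i)
      ≡⟨ coeff-∑ₚ (λ k → scale (+ F k) (tMinus1^ (d ∸ k))) (L.upTo (suc d)) (d ∸ i) ⟩
    ∑List (L.upTo (suc d)) (λ k → coeff (scale (+ F k) (tMinus1^ (d ∸ k))) (d ∸ i))
      ≡⟨ ∑List-applyUpTo (suc d) (λ k → k) (λ k → coeff (scale (+ F k) (tMinus1^ (d ∸ k))) (d ∸ i)) ⟩
    ∑ (suc d) (λ k → coeff (scale (+ F k) (tMinus1^ (d ∸ k))) (d ∸ i))
      ≡⟨ ∑-cong (suc d) (λ k _ → trans (coeff-scale (+ F k) (tMinus1^ (d ∸ k)) (d ∸ i))
                                       (cong (+ F k *_) (coeff-tMinus1^ (d ∸ k) (d ∸ i)))) ⟩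
    hVector d (+_ ∘ F) i ∎
  where open ≡-Reasoning

hCoeff-diag : ∀ d i → hCoeff d i i ≡ + 1
hCoeff-diag d i = cong₂ _*_ (trans (-1^-+ (d ∸ i) (d ∸ i)) (-1^-square (d ∸ i))) (binom-diag (d ∸ i))

hCoeff-upper : ∀ d i k → i ℕ.< k → k ℕ.≤ d → hCoeff d i k ≡ + 0
hCoeff-upper d i k i<k k≤d =
  trans (cong (-1^ ((d ∸ k) ℕ.+ (d ∸ i)) *_) (binom-vanishes (d ∸ k) (d ∸ i) (ℕP.∸-monoʳ-< i<k k≤d)))
        (ℤP.*-zeroʳ (-1^ ((d ∸ k) ℕ.+ (d ∸ i))))

-- binomDrop a q k = binom a (q ∸ k) for k ≤ q, but 0 (not binom a 0) for q < k.
binomDrop : ℕ → ℕ → ℕ → ℤ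
binomDrop a q zero = binom a q
binomDrop a zero (suc k) = + 0
binomDrop a (suc q) (suc k) = binomDrop a q k

binomDrop-complement : ∀ k a i → i ℕ.≤ k ℕ.+ a → binomDrop a ((k ℕ.+ a) ∸ i) k ≡ binom a i
binomDrop-complement zero a i i≤a = binom-complement a i i≤a
binomDrop-complement (suc k) a i i≤k+a with ℕP.m≤n⇒m<n∨m≡n i≤k+a
... | inj₂ refl = trans (cong (λ q → binomDrop a q (suc k)) (ℕP.n∸n≡0 (suc k ℕ.+ a)))
                        (sym (binom-vanishes a (suc k ℕ.+ a) (s≤s (ℕP.m≤n+m a k))))
... | inj₁ (s≤s i<k+a) = trans (cong (λ q → binomDrop a q (suc k)) (ℕP.+-∸-assoc 1 i<k+a))
                               (binomDrop-complement k a i i<k+a)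

∑-alternating-binom : ∀ k a q →
  ∑ (suc k) (λ j → -1^ j * binom k j * binom (a ℕ.+ (k ∸ j)) q) ≡ binomDrop a q k
∑-alternating-binom zero a q =
  trans (ℤP.+-identityʳ _) (trans (ℤP.*-identityˡ _) (cong (λ n → binom n q) (ℕP.+-identityʳ a)))
∑-alternating-binom (suc k) a q = begin
    ∑ (suc (suc k)) (λ j → -1^ j * binom (suc k) j * binom (a ℕ.+ (suc k ∸ j)) q)
      ≡⟨ ∑-cong (suc (suc k)) (λ j _ → commute (-1^ j) (binom (suc k) j) (binom (a ℕ.+ (suc k ∸ j)) q)) ⟩
    ∑ (suc (suc k)) (λ j → binom (suc k) j * G j)
      ≡⟨ ∑-pascal k G ⟩
    ∑ (suc k) (λ j → binom k j * (G j + G (suc j)))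
      ≡⟨ telescope q ⟩
    binomDrop a q (suc k) ∎
  where
  open ≡-Reasoning
  G : ℕ → ℤ
  G j = -1^ j * binom (a ℕ.+ (suc k ∸ j)) q
  commute : ∀ s b x → s * b * x ≡ b * (s * x)
  commute = solve-∀
  a+[1+k∸j] : ∀ j → j ℕ.< suc k → a ℕ.+ (suc k ∸ j) ≡ suc (a ℕ.+ (k ∸ j))
  a+[1+k∸j] j (s≤s j≤k) = trans (cong (a ℕ.+_) (ℕP.+-∸-assoc 1 j≤k)) (ℕP.+-suc a (k ∸ j))
  telescope : ∀ q → ∑ (suc k) (λ j → binom k j * (-1^ j * binom (a ℕ.+ (suc k ∸ j)) q + - -1^ j * binom (a ℕ.+ (k ∸ j)) q))
                    ≡ binomDrop a q (suc k)
  telescope zero = ∑-zero (suc k) (λ j _ → cancel (binom k j) (-1^ j))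
    where
    cancel : ∀ b s → b * (s * + 1 + (- s) * + 1) ≡ + 0
    cancel = solve-∀
  telescope (suc q) = trans (∑-cong (suc k) pascal-step) (∑-alternating-binom k a q)
    where
    cancel : ∀ b s x y → b * (s * (x + y) + (- s) * y) ≡ s * b * x
    cancel = solve-∀
    pascal-step : ∀ j → j ℕ.< suc k →
      binom k j * (-1^ j * binom (a ℕ.+ (suc k ∸ j)) (suc q) + - -1^ j * binom (a ℕ.+ (k ∸ j)) (suc q))
      ≡ -1^ j * binom k j * binom (a ℕ.+ (k ∸ j)) q
    pascal-step j j<1+k =
      trans (cong (λ n → binom k j * (-1^ j * binom n (suc q) + - -1^ j * binom (a ℕ.+ (k ∸ j)) (suc q)))
                  (a+[1+k∸j] j j<1+k))
            (cancel (binom k j) (-1^ j) (binom (a ℕ.+ (k ∸ j)) q) (binom (a ℕ.+ (k ∸ j)) (suc q)))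

dualCoeff : ℕ → ℕ → ℕ → ℤ
dualCoeff d j k = -1^ (d ℕ.+ k) * binom k j

dual : ℕ → (ℕ → ℤ) → ℕ → ℤ
dual d v j = ∑ (suc d) (λ k → dualCoeff d j k * v k)

hCoeff-reverse : ∀ d i k → i ℕ.≤ d → k ℕ.≤ d →
  ∑ (suc d) (λ j → hCoeff d i j * dualCoeff d j k) ≡ hCoeff d (d ∸ i) k
hCoeff-reverse d i k i≤d k≤d with ℕP.m≤n⇒∃[o]m+o≡n k≤d
... | a , refl = begin
    ∑ (suc d) (λ j → hCoeff d i j * dualCoeff d j k)
      ≡⟨ ∑-vanishing-tail (suc k) (suc d) (λ j → hCoeff d i j * dualCoeff d j k) (s≤s k≤d)
           (λ j k<j → trans (cong (λ b → hCoeff d i j * (-1^ (d ℕ.+ k) * b)) (binom-vanishes k j k<j))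
                            (vanish (hCoeff d i j) (-1^ (d ℕ.+ k)))) ⟩
    ∑ (suc k) (λ j → hCoeff d i j * dualCoeff d j k)
      ≡⟨ ∑-cong (suc k) (λ j j<1+k → term j (ℕP.≤-pred j<1+k)) ⟩
    ∑ (suc k) (λ j → S * (-1^ j * binom k j * binom (a ℕ.+ (k ∸ j)) q))
      ≡⟨ ∑-*ˡ (suc k) S (λ j → -1^ j * binom k j * binom (a ℕ.+ (k ∸ j)) q) ⟩
    S * ∑ (suc k) (λ j → -1^ j * binom k j * binom (a ℕ.+ (k ∸ j)) q)
      ≡⟨ cong (S *_) (trans (∑-alternating-binom k a q) (binomDrop-complement k a i i≤d)) ⟩
    S * binom a i
      ≡⟨ cong (λ n → S * binom n i) (sym (ℕP.m+n∸m≡n k a)) ⟩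
    S * binom (d ∸ k) i
      ≡⟨ cong (λ t → -1^ ((d ∸ k) ℕ.+ t) * binom (d ∸ k) t) (sym (ℕP.m∸[m∸n]≡n i≤d)) ⟩
    hCoeff d (d ∸ i) k ∎
  where
  open ≡-Reasoning
  q = d ∸ i
  S = -1^ ((d ∸ k) ℕ.+ i)
  vanish : ∀ x s → x * (s * + 0) ≡ + 0
  vanish = solve-∀
  term : ∀ j → j ℕ.≤ k → hCoeff d i j * dualCoeff d j k ≡ S * (-1^ j * binom k j * binom (a ℕ.+ (k ∸ j)) q)
  term j j≤k = begin
    -1^ ((d ∸ j) ℕ.+ q) * binom (d ∸ j) q * (-1^ (d ℕ.+ k) * binom k j)
      ≡⟨ separate (-1^ ((d ∸ j) ℕ.+ q)) (binom (d ∸ j) q) (-1^ (d ℕ.+ k)) (binom k j) ⟩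
    (-1^ ((d ∸ j) ℕ.+ q) * -1^ (d ℕ.+ k)) * (binom k j * binom (d ∸ j) q)
      ≡⟨ cong₂ (λ s n → s * (binom k j * binom n q))
               (-1^-reindex d i j k i≤d (ℕP.≤-trans j≤k k≤d) k≤d)
               (trans (ℕP.+-∸-comm a j≤k) (ℕP.+-comm (k ∸ j) a)) ⟩
    S * -1^ j * (binom k j * binom (a ℕ.+ (k ∸ j)) q)
      ≡⟨ reassoc S (-1^ j) (binom k j) (binom (a ℕ.+ (k ∸ j)) q) ⟩
    S * (-1^ j * binom k j * binom (a ℕ.+ (k ∸ j)) q) ∎
    where
    separate : ∀ s₁ b₁ s₂ b₂ → s₁ * b₁ * (s₂ * b₂) ≡ (s₁ * s₂) * (b₂ * b₁)
    separate = solve-∀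
    reassoc : ∀ S sj b x → S * sj * (b * x) ≡ S * (sj * b * x)
    reassoc = solve-∀

hVector≡0⇒≡0 : ∀ d (v : ℕ → ℤ) → (∀ i → i ℕ.≤ d → hVector d v i ≡ + 0) → ∀ k → k ℕ.≤ d → v k ≡ + 0
hVector≡0⇒≡0 d v h≡0 = <-rec (λ k → k ℕ.≤ d → v k ≡ + 0) step
  where
  step : ∀ k → (∀ {m} → m ℕ.< k → m ℕ.≤ d → v m ≡ + 0) → k ℕ.≤ d → v k ≡ + 0
  step k ih k≤d = begin
      v k                                         ≡⟨ sym (∑-δ (suc d) k v (s≤s k≤d)) ⟩
      ∑ (suc d) (λ m → 𝟙 (does (k ℕ.≟ m)) * v m) ≡⟨ ∑-cong (suc d) (λ m m<1+d → triangular m (ℕP.≤-pred m<1+d)) ⟨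
      hVector d v k                               ≡⟨ h≡0 k k≤d ⟩
      + 0                                         ∎
    where
    open ≡-Reasoning
    triangular : ∀ m → m ℕ.≤ d → v m * hCoeff d k m ≡ 𝟙 (does (k ℕ.≟ m)) * v m
    triangular m m≤d with ℕP.<-cmp k m
    ... | tri< k<m k≢m _ = begin
      v m * hCoeff d k m                   ≡⟨ cong (v m *_) (hCoeff-upper d k m k<m m≤d) ⟩
      v m * + 0                            ≡⟨ ℤP.*-zeroʳ (v m) ⟩
      + 0                                  ≡⟨ sym (ℤP.*-zeroˡ (v m)) ⟩
      𝟙 false * v m                        ≡⟨ cong (λ b → 𝟙 b * v m) (sym (dec-false (k ℕ.≟ m) k≢m)) ⟩
      𝟙 (does (k ℕ.≟ m)) * v m             ∎
    ... | tri≈ _ refl _ = begin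
      v k * hCoeff d k k                   ≡⟨ cong (v k *_) (hCoeff-diag d k) ⟩
      v k * + 1                            ≡⟨ ℤP.*-comm (v k) (+ 1) ⟩
      𝟙 true * v k                         ≡⟨ cong (λ b → 𝟙 b * v k) (sym (dec-true (k ℕ.≟ k) refl)) ⟩
      𝟙 (does (k ℕ.≟ k)) * v k             ∎
    ... | tri> _ k≢m m<k = begin
      v m * hCoeff d k m                   ≡⟨ cong (_* hCoeff d k m) (ih m<k m≤d) ⟩
      + 0 * hCoeff d k m                   ≡⟨ ℤP.*-zeroˡ (hCoeff d k m) ⟩
      + 0                                  ≡⟨ sym (ℤP.*-zeroˡ (v m)) ⟩
      𝟙 false * v m                        ≡⟨ cong (λ b → 𝟙 b * v m) (sym (dec-false (k ℕ.≟ m) k≢m)) ⟩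
      𝟙 (does (k ℕ.≟ m)) * v m             ∎

hVector-reverse : ∀ d v i → i ℕ.≤ d → hVector d v (d ∸ i) ≡ hVector d (dual d v) i
hVector-reverse d v i i≤d = begin
    ∑ (suc d) (λ k → v k * hCoeff d (d ∸ i) k)
      ≡⟨ ∑-cong (suc d) (λ k k<1+d → trans (cong (v k *_) (sym (hCoeff-reverse d i k i≤d (ℕP.≤-pred k<1+d))))
                                          (sym (∑-*ˡ (suc d) (v k) (λ j → hCoeff d i j * dualCoeff d j k)))) ⟩
    ∑ (suc d) (λ k → ∑ (suc d) (λ j → v k * (hCoeff d i j * dualCoeff d j k)))
      ≡⟨ ∑-swap (suc d) (suc d) (λ k j → v k * (hCoeff d i j * dualCoeff d j k)) ⟩
    ∑ (suc d) (λ j → ∑ (suc d) (λ k → v k * (hCoeff d i j * dualCoeff d j k)))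
      ≡⟨ ∑-cong (suc d) (λ j _ → trans (∑-cong (suc d) (λ k _ → reassoc (v k) (hCoeff d i j) (dualCoeff d j k)))
                                       (trans (∑-*ˡ (suc d) (hCoeff d i j) (λ k → dualCoeff d j k * v k))
                                              (ℤP.*-comm (hCoeff d i j) (dual d v j)))) ⟩
    ∑ (suc d) (λ j → dual d v j * hCoeff d i j) ∎
  where
  open ≡-Reasoning
  reassoc : ∀ v m e → v * (m * e) ≡ m * (e * v)
  reassoc = solve-∀

hVector-- : ∀ d v w i → hVector d (λ k → v k - w k) i ≡ hVector d v i - hVector d w i
hVector-- d v w i = trans (∑-cong (suc d) (λ k _ → distrib (v k) (w k) (hCoeff d i k)))
                          (∑-- (suc d) (λ k → v k * hCoeff d i k) (λ k → w k * hCoeff d i k))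
  where
  distrib : ∀ a b m → (a - b) * m ≡ a * m - b * m
  distrib = solve-∀

reciprocal⇒dual-fixed : ∀ d v → (∀ i → i ℕ.≤ d → hVector d v i ≡ hVector d v (d ∸ i)) →
  ∀ j → j ℕ.≤ d → dual d v j ≡ v j
reciprocal⇒dual-fixed d v reciprocal j j≤d =
  ℤP.i-j≡0⇒i≡j (dual d v j) (v j) (hVector≡0⇒≡0 d (λ k → dual d v k - v k) h≡0 j j≤d)
  where
  h≡0 : ∀ i → i ℕ.≤ d → hVector d (λ k → dual d v k - v k) i ≡ + 0
  h≡0 i i≤d = begin
    hVector d (λ k → dual d v k - v k) i            ≡⟨ hVector-- d (dual d v) v i ⟩
    hVector d (dual d v) i - hVector d v i          ≡⟨ cong₂ _-_ (sym (hVector-reverse d v i i≤d)) (reciprocal i i≤d) ⟩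
    hVector d v (d ∸ i) - hVector d v (d ∸ i)       ≡⟨ ℤP.+-inverseʳ (hVector d v (d ∸ i)) ⟩
    + 0                                             ∎
    where open ≡-Reasoning

dual-fixed⇒reciprocal : ∀ d v → (∀ j → j ℕ.≤ d → dual d v j ≡ v j) →
  ∀ i → i ℕ.≤ d → hVector d v i ≡ hVector d v (d ∸ i)
dual-fixed⇒reciprocal d v fixed i i≤d =
  sym (trans (hVector-reverse d v i i≤d)
             (∑-cong (suc d) (λ j j<1+d → cong (_* hCoeff d i j) (fixed j (ℕP.≤-pred j<1+d)))))

-1^-via : ∀ d k m → -1^ (d ℕ.+ m) ≡ -1^ (d ℕ.+ k) * -1^ (k ℕ.+ m)
-1^-via d k m = begin
    -1^ (d ℕ.+ m)                               ≡⟨ -1^-+ d m ⟩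
    -1^ d * -1^ m                               ≡⟨ sym (ℤP.*-identityˡ _) ⟩
    + 1 * (-1^ d * -1^ m)                       ≡⟨ cong (_* (-1^ d * -1^ m)) (sym (-1^-square k)) ⟩
    -1^ k * -1^ k * (-1^ d * -1^ m)             ≡⟨ regroup (-1^ d) (-1^ k) (-1^ m) ⟩
    -1^ d * -1^ k * (-1^ k * -1^ m)             ≡⟨ sym (cong₂ _*_ (-1^-+ d k) (-1^-+ k m)) ⟩
    -1^ (d ℕ.+ k) * -1^ (k ℕ.+ m)               ∎
  where
  open ≡-Reasoning
  regroup : ∀ a b c → b * b * (a * c) ≡ a * b * (b * c)
  regroup = solve-∀

∑-dualCoeff-surj : ∀ d j k → k ℕ.≤ d →
  ∑ (suc d) (λ m → dualCoeff d j m * surj k m) ≡ -1^ (d ℕ.+ k) * ∑ (suc d) (λ m → binom k m * surj m j)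
∑-dualCoeff-surj d j k k≤d = begin
    ∑ (suc d) (λ m → dualCoeff d j m * surj k m)
      ≡⟨ ∑-vanishing-tail (suc k) (suc d) (λ m → dualCoeff d j m * surj k m) (s≤s k≤d)
           (λ m k<m → trans (cong (dualCoeff d j m *_) (surj-vanishes k m k<m)) (ℤP.*-zeroʳ (dualCoeff d j m))) ⟩
    ∑ (suc k) (λ m → dualCoeff d j m * surj k m)
      ≡⟨ ∑-cong (suc k) (λ m _ → trans (cong (λ s → s * binom m j * surj k m) (-1^-via d k m))
                                       (reassoc (-1^ (d ℕ.+ k)) (-1^ (k ℕ.+ m)) (binom m j) (surj k m))) ⟩
    ∑ (suc k) (λ m → -1^ (d ℕ.+ k) * (-1^ (k ℕ.+ m) * (binom m j * surj k m)))
      ≡⟨ ∑-*ˡ (suc k) (-1^ (d ℕ.+ k)) (λ m → -1^ (k ℕ.+ m) * (binom m j * surj k m)) ⟩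
    -1^ (d ℕ.+ k) * alternatingSurj k j
      ≡⟨ cong (-1^ (d ℕ.+ k) *_) (trans (alternatingSurj≡surj⁺ k j) (sym (∑-binom-surj k j))) ⟩
    -1^ (d ℕ.+ k) * ∑ (suc k) (λ m → binom k m * surj m j)
      ≡⟨ cong (-1^ (d ℕ.+ k) *_) (sym (binom-vanishing-tail k≤d (λ m → surj m j))) ⟩
    -1^ (d ℕ.+ k) * ∑ (suc d) (λ m → binom k m * surj m j) ∎
  where
  open ≡-Reasoning
  reassoc : ∀ a b x y → a * b * x * y ≡ a * (b * (x * y))
  reassoc = solve-∀

surjTransform : ℕ → (ℕ → ℤ) → ℕ → ℤ
surjTransform d v j = ∑ (suc d) (λ k → v k * surj k j)

dual-fixed-surjTransform : ∀ d v → (∀ j → j ℕ.≤ d → dual d v j ≡ v j) →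
  ∀ j → j ℕ.≤ d → dual d (surjTransform d v) j ≡ surjTransform d v j
dual-fixed-surjTransform d v fixed j j≤d = begin
    ∑ (suc d) (λ m → dualCoeff d j m * ∑ (suc d) (λ k → v k * surj k m))
      ≡⟨ ∑-cong (suc d) (λ m _ → trans (sym (∑-*ˡ (suc d) (dualCoeff d j m) (λ k → v k * surj k m)))
                                       (∑-cong (suc d) (λ k _ → swap₃ (dualCoeff d j m) (v k) (surj k m)))) ⟩
    ∑ (suc d) (λ m → ∑ (suc d) (λ k → v k * (dualCoeff d j m * surj k m)))
      ≡⟨ ∑-swap (suc d) (suc d) (λ m k → v k * (dualCoeff d j m * surj k m)) ⟩
    ∑ (suc d) (λ k → ∑ (suc d) (λ m → v k * (dualCoeff d j m * surj k m)))
      ≡⟨ ∑-cong (suc d) (λ k k<1+d → trans (∑-*ˡ (suc d) (v k) (λ m → dualCoeff d j m * surj k m))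
                                   (trans (cong (v k *_) (∑-dualCoeff-surj d j k (ℕP.≤-pred k<1+d)))
                                   (trans (cong (v k *_) (sym (∑-*ˡ (suc d) (-1^ (d ℕ.+ k)) (λ m → binom k m * surj m j))))
                                   (trans (sym (∑-*ˡ (suc d) (v k) (λ m → -1^ (d ℕ.+ k) * (binom k m * surj m j))))
                                          (∑-cong (suc d) (λ m _ → regroup (v k) (-1^ (d ℕ.+ k)) (binom k m) (surj m j))))))) ⟩
    ∑ (suc d) (λ k → ∑ (suc d) (λ m → surj m j * (dualCoeff d m k * v k)))
      ≡⟨ ∑-swap (suc d) (suc d) (λ k m → surj m j * (dualCoeff d m k * v k)) ⟩
    ∑ (suc d) (λ m → ∑ (suc d) (λ k → surj m j * (dualCoeff d m k * v k)))
      ≡⟨ ∑-cong (suc d) (λ m m<1+d → trans (∑-*ˡ (suc d) (surj m j) (λ k → dualCoeff d m k * v k))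
                                           (trans (cong (surj m j *_) (fixed m (ℕP.≤-pred m<1+d)))
                                                  (ℤP.*-comm (surj m j) (v m)))) ⟩
    surjTransform d v j ∎
  where
  open ≡-Reasoning
  swap₃ : ∀ e w c → e * (w * c) ≡ w * (e * c)
  swap₃ = solve-∀
  regroup : ∀ w s b c → w * (s * (b * c)) ≡ c * (s * b * w)
  regroup = solve-∀

reciprocal-surjTransform : ∀ d (F G : ℕ → ℕ) → (∀ j → j ℕ.≤ d → + G j ≡ surjTransform d (+_ ∘ F) j) →
  Reciprocal d (hVec d F) → Reciprocal d (hVec d G)
reciprocal-surjTransform d F G G≡ recF i i≤d = begin
    hVec d G i                  ≡⟨ hVec≡hVector d G i ⟩
    hVector d (+_ ∘ G) i        ≡⟨ dual-fixed⇒reciprocal d (+_ ∘ G) G-fixed i i≤d ⟩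
    hVector d (+_ ∘ G) (d ∸ i)  ≡⟨ sym (hVec≡hVector d G (d ∸ i)) ⟩
    hVec d G (d ∸ i)            ∎
  where
  open ≡-Reasoning
  F-fixed : ∀ j → j ℕ.≤ d → dual d (+_ ∘ F) j ≡ + F j
  F-fixed = reciprocal⇒dual-fixed d (+_ ∘ F) λ i i≤d →
    trans (sym (hVec≡hVector d F i)) (trans (recF i i≤d) (hVec≡hVector d F (d ∸ i)))
  G-fixed : ∀ j → j ℕ.≤ d → dual d (+_ ∘ G) j ≡ + G j
  G-fixed j j≤d = begin
    dual d (+_ ∘ G) j                   ≡⟨ ∑-cong (suc d) (λ k k<1+d → cong (dualCoeff d j k *_) (G≡ k (ℕP.≤-pred k<1+d))) ⟩
    dual d (surjTransform d (+_ ∘ F)) j ≡⟨ dual-fixed-surjTransform d (+_ ∘ F) F-fixed j j≤d ⟩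
    surjTransform d (+_ ∘ F) j          ≡⟨ sym (G≡ j j≤d) ⟩
    + G j                               ∎

-- Subsets of a finite set

_≟ˢ_ : ∀ {k} → DecidableEquality (Subset k)
_≟ˢ_ = ≡-dec BoolP._≟_

∑Subset : (k : ℕ) → (Subset k → ℤ) → ℤ
∑Subset zero F = F []
∑Subset (suc k) F = ∑Subset k (F ∘ (false ∷_)) + ∑Subset k (F ∘ (true ∷_))

∑Subset-cong : ∀ k {F G : Subset k → ℤ} → (∀ S → F S ≡ G S) → ∑Subset k F ≡ ∑Subset k G
∑Subset-cong zero e = e []
∑Subset-cong (suc k) e = cong₂ _+_ (∑Subset-cong k (e ∘ (false ∷_))) (∑Subset-cong k (e ∘ (true ∷_)))

∑Subset-zero : ∀ k {F : Subset k → ℤ} → (∀ S → F S ≡ + 0) → ∑Subset k F ≡ + 0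
∑Subset-zero zero e = e []
∑Subset-zero (suc k) e = cong₂ _+_ (∑Subset-zero k (e ∘ (false ∷_))) (∑Subset-zero k (e ∘ (true ∷_)))

∑Subset-+ : ∀ k (F G : Subset k → ℤ) → ∑Subset k (λ S → F S + G S) ≡ ∑Subset k F + ∑Subset k G
∑Subset-+ zero F G = refl
∑Subset-+ (suc k) F G =
  trans (cong₂ _+_ (∑Subset-+ k (F ∘ (false ∷_)) (G ∘ (false ∷_))) (∑Subset-+ k (F ∘ (true ∷_)) (G ∘ (true ∷_))))
        (interchange (∑Subset k (F ∘ (false ∷_))) (∑Subset k (G ∘ (false ∷_)))
                     (∑Subset k (F ∘ (true ∷_))) (∑Subset k (G ∘ (true ∷_))))
  where
  interchange : ∀ a b c d → a + b + (c + d) ≡ a + c + (b + d)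
  interchange = solve-∀

sum-∑Subset : ∀ {n} k (F : Fin n → Subset k → ℤ) →
  sum (λ i → ∑Subset k (F i)) ≡ ∑Subset k (λ S → sum (λ i → F i S))
sum-∑Subset k = sum-commute (∑Subset k) (∑Subset-+ k) (∑Subset-zero k (λ _ → refl))

∑Subset-δ : ∀ k (T : Subset k) (G : Subset k → ℤ) → ∑Subset k (λ S → 𝟙 (does (S ≟ˢ T)) * G S) ≡ G T
∑Subset-δ zero [] G = ℤP.*-identityˡ _
∑Subset-δ (suc k) (false ∷ T) G =
  trans (cong₂ _+_ (∑Subset-δ k T (G ∘ (false ∷_))) (∑Subset-zero k (λ _ → refl))) (ℤP.+-identityʳ _)
∑Subset-δ (suc k) (true ∷ T) G =
  trans (cong₂ _+_ (∑Subset-zero k (λ _ → refl)) (∑Subset-δ k T (G ∘ (true ∷_)))) (ℤP.+-identityˡ _)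

corank : ∀ {k} → Subset k → ℕ
corank S = ∣ ∁ S ∣

corank-⊥ : ∀ k → corank (⊥ {k}) ≡ k
corank-⊥ k = trans (∣∁p∣≡n∸∣p∣ (⊥ {k})) (cong (k ∸_) (∣⊥∣≡0 k))

∑-supersets : ∀ k (S : Subset k) (G : ℕ → ℤ) →
  ∑Subset k (λ T → 𝟙 (does (S ⊆? T)) * G (corank T)) ≡ ∑ (suc (corank S)) (λ p → binom (corank S) p * G p)
∑-supersets zero [] G = sym (ℤP.+-identityʳ _)
∑-supersets (suc k) (true ∷ S) G =
  trans (cong (_+ ∑Subset k (λ T → 𝟙 (does (S ⊆? T)) * G (corank T))) (∑Subset-zero k (λ _ → refl)))
        (trans (ℤP.+-identityˡ _) (∑-supersets k S G))
∑-supersets (suc k) (false ∷ S) G = begin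
    ∑Subset k (λ T → 𝟙 (does (S ⊆? T)) * G (suc (corank T))) + ∑Subset k (λ T → 𝟙 (does (S ⊆? T)) * G (corank T))
      ≡⟨ cong₂ _+_ (∑-supersets k S (G ∘ suc)) (∑-supersets k S G) ⟩
    ∑ (suc z) (λ p → binom z p * G (suc p)) + ∑ (suc z) (λ p → binom z p * G p)
      ≡⟨ ℤP.+-comm (∑ (suc z) (λ p → binom z p * G (suc p))) _ ⟩
    ∑ (suc z) (λ p → binom z p * G p) + ∑ (suc z) (λ p → binom z p * G (suc p))
      ≡⟨ sym (∑-+ (suc z) (λ p → binom z p * G p) (λ p → binom z p * G (suc p))) ⟩
    ∑ (suc z) (λ p → binom z p * G p + binom z p * G (suc p))
      ≡⟨ ∑-cong (suc z) (λ p _ → sym (ℤP.*-distribˡ-+ (binom z p) (G p) (G (suc p)))) ⟩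
    ∑ (suc z) (λ p → binom z p * (G p + G (suc p)))
      ≡⟨ sym (∑-pascal z G) ⟩
    ∑ (suc (suc z)) (λ p → binom (suc z) p * G p) ∎
  where
  open ≡-Reasoning
  z = corank S

𝟙-⊆?-split : ∀ {k} (S T : Subset k) →
  𝟙 (does (S ⊆? T)) ≡ 𝟙 (does (S ⊆? T) ∧ not (does (S ≟ˢ T))) + 𝟙 (does (T ≟ˢ S))
𝟙-⊆?-split S T with T ≟ˢ S
... | yes refl rewrite dec-true (S ⊆? S) ⊆-refl | dec-true (S ≟ˢ S) refl = refl
... | no T≢S = begin
    𝟙 (does (S ⊆? T))                             ≡⟨ cong 𝟙 (BoolP.∧-identityʳ _) ⟨
    𝟙 (does (S ⊆? T) ∧ true)                      ≡⟨ cong (λ b → 𝟙 (does (S ⊆? T) ∧ not b)) (dec-false (S ≟ˢ T) (T≢S ∘ sym)) ⟨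
    𝟙 (does (S ⊆? T) ∧ not (does (S ≟ˢ T)))       ≡⟨ ℤP.+-identityʳ _ ⟨
    𝟙 (does (S ⊆? T) ∧ not (does (S ≟ˢ T))) + + 0 ∎
  where open ≡-Reasoning

surj-corank-zero : ∀ {k} (S : Subset k) → surj (corank S) 0 ≡ 𝟙 (does (S ≟ˢ ⊤))
surj-corank-zero [] = refl
surj-corank-zero (true ∷ S) = surj-corank-zero S
surj-corank-zero (false ∷ S) = refl

singletonᵇ : ∀ {k} → Subset k → Bool
singletonᵇ [] = false
singletonᵇ (true ∷ T) = does (T ≟ˢ ⊥)
singletonᵇ (false ∷ T) = singletonᵇ T

∑Subset-singletonᵇ : ∀ k → ∑Subset k (𝟙 ∘ singletonᵇ) ≡ + k
∑Subset-singletonᵇ zero = refl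
∑Subset-singletonᵇ (suc k) = begin
    ∑Subset k (𝟙 ∘ singletonᵇ) + ∑Subset k (λ T → 𝟙 (does (T ≟ˢ ⊥)))
      ≡⟨ cong₂ _+_ (∑Subset-singletonᵇ k)
                   (trans (∑Subset-cong k (λ T → sym (ℤP.*-identityʳ (𝟙 (does (T ≟ˢ ⊥))))))
                          (∑Subset-δ k ⊥ (λ _ → + 1))) ⟩
    + k + + 1 ≡⟨ cong +_ (ℕP.+-comm k 1) ⟩
    + suc k ∎
  where open ≡-Reasoning

minimalOver : ∀ {k} → Subset k → Subset k → Bool
minimalOver T U = not (does (U ⊆? T)) ∨ does (U ≟ˢ ⊥) ∨ does (U ≟ˢ T)

⊆⊥⇒≡⊥ᵇ : ∀ {k} (U : Subset k) → not (does (U ⊆? ⊥)) ∨ does (U ≟ˢ ⊥) ≡ true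
⊆⊥⇒≡⊥ᵇ U with U ⊆? ⊥
... | yes U⊆⊥ = dec-true (U ≟ˢ ⊥) (⊆-antisym U⊆⊥ (⊆-min U))
... | no _ = refl

singletonᵇ⇒atom : ∀ {k} (T : Subset k) → singletonᵇ T ≡ true →
  not (does (T ≟ˢ ⊥)) ≡ true × (∀ U → minimalOver T U ≡ true)
singletonᵇ⇒atom (true ∷ T) singleton with T ≟ˢ ⊥
singletonᵇ⇒atom (true ∷ .⊥) refl | yes refl = refl , minimal
  where
  minimal : ∀ U → minimalOver (true ∷ ⊥) U ≡ true
  minimal (false ∷ U) =
    trans (cong (λ b → not (does (U ⊆? ⊥)) ∨ b) (BoolP.∨-identityʳ (does (U ≟ˢ ⊥)))) (⊆⊥⇒≡⊥ᵇ U)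
  minimal (true ∷ U) = ⊆⊥⇒≡⊥ᵇ U
singletonᵇ⇒atom (false ∷ T) singleton = proj₁ (singletonᵇ⇒atom T singleton) , minimal
  where
  minimal : ∀ U → minimalOver (false ∷ T) U ≡ true
  minimal (false ∷ U) = proj₂ (singletonᵇ⇒atom T singleton) U
  minimal (true ∷ U) = refl

atom⇒singletonᵇ : ∀ {k} (T : Subset k) → not (does (T ≟ˢ ⊥)) ≡ true → (∀ U → minimalOver T U ≡ true) →
  singletonᵇ T ≡ true
atom⇒singletonᵇ (true ∷ T) _ minimal = begin
    does (T ≟ˢ ⊥)                      ≡⟨ BoolP.∨-identityʳ _ ⟨
    does (T ≟ˢ ⊥) ∨ false              ≡⟨ cong (λ b → not b ∨ does (T ≟ˢ ⊥) ∨ false) (dec-true (T ⊆? T) ⊆-refl) ⟨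
    minimalOver (true ∷ T) (false ∷ T) ≡⟨ minimal (false ∷ T) ⟩
    true                               ∎
  where open ≡-Reasoning
atom⇒singletonᵇ (false ∷ T) T≢⊥ minimal = atom⇒singletonᵇ T T≢⊥ (minimal ∘ (false ∷_))

does-≟-sym : ∀ {A : Set} (_≟_ : DecidableEquality A) (x y : A) → does (x ≟ y) ≡ does (y ≟ x)
does-≟-sym _≟_ x y with x ≟ y | y ≟ x
... | yes _ | yes _ = refl
... | no _ | no _ = refl
... | yes x≡y | no y≢x = contradiction (sym x≡y) y≢x
... | no x≢y | yes y≡x = contradiction (sym y≡x) x≢y

and-tabulate⁻ : ∀ m (P : Fin m → Bool) → and (L.tabulate P) ≡ true → ∀ i → P i ≡ true
and-tabulate⁻ (suc m) P all-true zero = BoolP.∧-conicalˡ _ _ all-true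
and-tabulate⁻ (suc m) P all-true (suc i) = and-tabulate⁻ m (P ∘ suc) (BoolP.∧-conicalʳ _ _ all-true) i

and-tabulate⁺ : ∀ m (P : Fin m → Bool) → (∀ i → P i ≡ true) → and (L.tabulate P) ≡ true
and-tabulate⁺ zero P _ = refl
and-tabulate⁺ (suc m) P all-true = cong₂ _∧_ (all-true zero) (and-tabulate⁺ m (P ∘ suc) (all-true ∘ suc))

-- Chains in a Boolean cell complex

module _ (Δ : BooleanCellComplex) where
  open BooleanCellComplex Δ hiding (f; fsd; HasDim)
  open IsDecPartialOrder isDPO using () renaming (refl to ≼-refl; trans to ≼-trans; antisym to ≼-antisym)

  ≼ᵇ-sound : ∀ {x y} → x ≼ᵇ y ≡ true → x ≼ y
  ≼ᵇ-sound {x} {y} x≼ᵇy with x ≤? y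
  ... | yes x≼y = x≼y

  chains : ℕ → Fin n → Fin n → ℤ
  chains zero x A = 𝟙 (x ≡ᵇ A)
  chains (suc j) x A = sum (λ y → 𝟙 (x ≺ᵇ y) * chains j y A)

  ≺ᵇ⇒nonemptyᵇ : ∀ x y → x ≺ᵇ y ≡ true → nonemptyᵇ y ≡ true
  ≺ᵇ⇒nonemptyᵇ x y x≺ᵇy with y FinP.≟ bot | x ≤? y | x FinP.≟ y
  ... | no _ | _ | _ = refl
  ... | yes refl | yes x≼bot | no x≢bot = contradiction (≼-antisym x≼bot (bot-least x)) x≢bot

  𝟙-≺ᵇ-nonemptyᵇ : ∀ x y → 𝟙 (x ≺ᵇ y) * 𝟙 (nonemptyᵇ y) ≡ 𝟙 (x ≺ᵇ y)
  𝟙-≺ᵇ-nonemptyᵇ x y with x ≺ᵇ y in x≺ᵇy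
  ... | false = refl
  ... | true = trans (ℤP.*-identityˡ _) (cong 𝟙 (≺ᵇ⇒nonemptyᵇ x y x≺ᵇy))

  nonemptyᵇ≡bot≺ᵇ : ∀ x → nonemptyᵇ x ≡ bot ≺ᵇ x
  nonemptyᵇ≡bot≺ᵇ x = begin
    not (x ≡ᵇ bot)                    ≡⟨ cong not (does-≟-sym FinP._≟_ x bot) ⟩
    not (bot ≡ᵇ x)                    ≡⟨ cong (λ b → b ∧ not (bot ≡ᵇ x)) (sym (dec-true (bot ≤? x) (bot-least x))) ⟩
    bot ≺ᵇ x                          ∎
    where open ≡-Reasoning

  ∑List-allVecs : ∀ j (G : Vec (Fin n) (suc j) → ℤ) →
    ∑List (allVecs (suc j)) G ≡ sum (λ x → ∑List (allVecs j) (G ∘ (x ∷_)))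
  ∑List-allVecs j G =
    trans (∑List-concatMap (λ x → L.map (x ∷_) (allVecs j)) (L.allFin n) G)
          (trans (∑List-tabulate n (λ x → x) (λ x → ∑List (L.map (x ∷_) (allVecs j)) G))
                 (sum-cong-≗ (λ x → ∑List-map (x ∷_) (allVecs j) G)))

  sum-𝟙-≡ᵇ : ∀ x → sum (λ A → 𝟙 (x ≡ᵇ A)) ≡ + 1
  sum-𝟙-≡ᵇ x = trans (sum-cong-≗ (λ A → sym (ℤP.*-identityʳ (𝟙 (x ≡ᵇ A))))) (sum-δ x (λ _ → + 1))

  sum-chains-suc : ∀ j x → sum (chains (suc j) x) ≡ sum (λ y → 𝟙 (x ≺ᵇ y) * sum (chains j y))
  sum-chains-suc j x = sym (trans (sum-cong-≗ (λ y → *-distribˡ-sum (𝟙 (x ≺ᵇ y)) (chains j y)))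
                                   (∑-comm (λ y A → 𝟙 (x ≺ᵇ y) * chains j y A)))

  ∑-chainᵇ : ∀ j x → ∑List (allVecs j) (λ v → 𝟙 (chainᵇ (x ∷ v))) ≡ 𝟙 (nonemptyᵇ x) * sum (chains j x)
  ∑-chainᵇ zero x = trans (ℤP.+-identityʳ (𝟙 (nonemptyᵇ x)))
                          (sym (trans (cong (𝟙 (nonemptyᵇ x) *_) (sum-𝟙-≡ᵇ x)) (ℤP.*-identityʳ (𝟙 (nonemptyᵇ x)))))
  ∑-chainᵇ (suc j) x = begin
    ∑List (allVecs (suc j)) (λ v → 𝟙 (chainᵇ (x ∷ v)))
      ≡⟨ ∑List-allVecs j (λ v → 𝟙 (chainᵇ (x ∷ v))) ⟩
    sum (λ y → ∑List (allVecs j) (λ v → 𝟙 (nonemptyᵇ x ∧ (x ≺ᵇ y) ∧ chainᵇ (y ∷ v))))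
      ≡⟨ sum-cong-≗ step ⟩
    sum (λ y → 𝟙 (nonemptyᵇ x) * (𝟙 (x ≺ᵇ y) * sum (chains j y)))
      ≡⟨ sym (*-distribˡ-sum (𝟙 (nonemptyᵇ x)) (λ y → 𝟙 (x ≺ᵇ y) * sum (chains j y))) ⟩
    𝟙 (nonemptyᵇ x) * sum (λ y → 𝟙 (x ≺ᵇ y) * sum (chains j y))
      ≡⟨ cong (𝟙 (nonemptyᵇ x) *_) (sym (sum-chains-suc j x)) ⟩
    𝟙 (nonemptyᵇ x) * sum (chains (suc j) x) ∎
    where
    open ≡-Reasoning
    reassoc : ∀ a b s e → a * (b * (e * s)) ≡ a * (b * e * s)
    reassoc = solve-∀
    step : ∀ y → ∑List (allVecs j) (λ v → 𝟙 (nonemptyᵇ x ∧ (x ≺ᵇ y) ∧ chainᵇ (y ∷ v))) ≡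
                 𝟙 (nonemptyᵇ x) * (𝟙 (x ≺ᵇ y) * sum (chains j y))
    step y = begin
      ∑List (allVecs j) (λ v → 𝟙 (nonemptyᵇ x ∧ (x ≺ᵇ y) ∧ chainᵇ (y ∷ v)))
        ≡⟨ ∑List-cong (allVecs j) (λ v → trans (𝟙-∧ (nonemptyᵇ x) _) (cong (𝟙 (nonemptyᵇ x) *_) (𝟙-∧ (x ≺ᵇ y) _))) ⟩
      ∑List (allVecs j) (λ v → 𝟙 (nonemptyᵇ x) * (𝟙 (x ≺ᵇ y) * 𝟙 (chainᵇ (y ∷ v))))
        ≡⟨ trans (∑List-*ˡ (allVecs j) (𝟙 (nonemptyᵇ x)) _)
                 (cong (𝟙 (nonemptyᵇ x) *_) (∑List-*ˡ (allVecs j) (𝟙 (x ≺ᵇ y)) _)) ⟩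
      𝟙 (nonemptyᵇ x) * (𝟙 (x ≺ᵇ y) * ∑List (allVecs j) (λ v → 𝟙 (chainᵇ (y ∷ v))))
        ≡⟨ cong (λ s → 𝟙 (nonemptyᵇ x) * (𝟙 (x ≺ᵇ y) * s)) (∑-chainᵇ j y) ⟩
      𝟙 (nonemptyᵇ x) * (𝟙 (x ≺ᵇ y) * (𝟙 (nonemptyᵇ y) * sum (chains j y)))
        ≡⟨ reassoc (𝟙 (nonemptyᵇ x)) (𝟙 (x ≺ᵇ y)) (sum (chains j y)) (𝟙 (nonemptyᵇ y)) ⟩
      𝟙 (nonemptyᵇ x) * (𝟙 (x ≺ᵇ y) * 𝟙 (nonemptyᵇ y) * sum (chains j y))
        ≡⟨ cong (λ t → 𝟙 (nonemptyᵇ x) * (t * sum (chains j y))) (𝟙-≺ᵇ-nonemptyᵇ x y) ⟩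
      𝟙 (nonemptyᵇ x) * (𝟙 (x ≺ᵇ y) * sum (chains j y)) ∎

  fsd≡∑chains : ∀ j → + fsd Δ j ≡ sum (chains j bot)
  fsd≡∑chains zero = trans (length-filterᵇ chainᵇ (allVecs 0)) (sym (sum-𝟙-≡ᵇ bot))
  fsd≡∑chains (suc j) = begin
    + fsd Δ (suc j)
      ≡⟨ trans (length-filterᵇ chainᵇ (allVecs (suc j))) (∑List-allVecs j (𝟙 ∘ chainᵇ)) ⟩
    sum (λ x → ∑List (allVecs j) (λ v → 𝟙 (chainᵇ (x ∷ v))))
      ≡⟨ sum-cong-≗ (λ x → trans (∑-chainᵇ j x) (cong (λ b → 𝟙 b * sum (chains j x)) (nonemptyᵇ≡bot≺ᵇ x))) ⟩
    sum (λ x → 𝟙 (bot ≺ᵇ x) * sum (chains j x))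
      ≡⟨ sym (sum-chains-suc j bot) ⟩
    sum (chains (suc j) bot) ∎
    where open ≡-Reasoning

  chains-outside : ∀ A j y → ¬ (y ≼ A) → chains j y A ≡ + 0
  chains-outside A zero y y⋠A = cong 𝟙 (dec-false (y FinP.≟ A) (λ { refl → y⋠A ≼-refl }))
  chains-outside A (suc j) y y⋠A = sum-zero term
    where
    term : ∀ z → 𝟙 (y ≺ᵇ z) * chains j z A ≡ + 0
    term z with z ≤? A
    ... | no z⋠A = trans (cong (𝟙 (y ≺ᵇ z) *_) (chains-outside A j z z⋠A)) (ℤP.*-zeroʳ (𝟙 (y ≺ᵇ z)))
    ... | yes z≼A with y ≺ᵇ z in y≺ᵇz
    ...   | false = refl
    ...   | true = contradiction (≼-trans (≼ᵇ-sound (BoolP.∧-conicalˡ _ _ y≺ᵇz)) z≼A) y⋠A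

  module BooleanInterval (A : Fin n) {k : ℕ} (φ : Subset k → Fin n) (φ≼A : ∀ S → φ S ≼ A)
    (φ-onto : ∀ B → B ≼ A → ∃ λ S → φ S ≡ B) (φ-order : ∀ S T → (S ⊆ T) ⇔ (φ S ≼ φ T)) where

    φ-injective : ∀ {S T} → φ S ≡ φ T → S ≡ T
    φ-injective {S} {T} φS≡φT =
      ⊆-antisym (Equivalence.from (φ-order S T) (subst (φ S ≼_) φS≡φT ≼-refl))
                (Equivalence.from (φ-order T S) (subst (φ T ≼_) (sym φS≡φT) ≼-refl))

    φ-≡ᵇ : ∀ S T → φ S ≡ᵇ φ T ≡ does (S ≟ˢ T)
    φ-≡ᵇ S T with S ≟ˢ T
    ... | yes refl = dec-true (φ S FinP.≟ φ S) refl
    ... | no S≢T = dec-false (φ S FinP.≟ φ T) (S≢T ∘ φ-injective)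

    φ-≼ᵇ : ∀ S T → φ S ≼ᵇ φ T ≡ does (S ⊆? T)
    φ-≼ᵇ S T with S ⊆? T
    ... | yes S⊆T = dec-true (φ S ≤? φ T) (Equivalence.to (φ-order S T) S⊆T)
    ... | no S⊈T = dec-false (φ S ≤? φ T) (S⊈T ∘ Equivalence.from (φ-order S T))

    φ-≺ᵇ : ∀ S T → φ S ≺ᵇ φ T ≡ does (S ⊆? T) ∧ not (does (S ≟ˢ T))
    φ-≺ᵇ S T = cong₂ (λ a b → a ∧ not b) (φ-≼ᵇ S T) (φ-≡ᵇ S T)

    φ⊤≡A : φ ⊤ ≡ A
    φ⊤≡A with φ-onto A ≼-refl
    ... | T , φT≡A = ≼-antisym (φ≼A ⊤) (subst (_≼ φ ⊤) φT≡A (Equivalence.to (φ-order T ⊤) ⊆⊤))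

    φ⊥≡bot : φ ⊥ ≡ bot
    φ⊥≡bot with φ-onto bot (bot-least A)
    ... | T , φT≡bot = ≼-antisym (subst (φ ⊥ ≼_) φT≡bot (Equivalence.to (φ-order ⊥ T) (⊆-min T))) (bot-least (φ ⊥))

    ∑-below : ∀ (G : Fin n → ℤ) → sum (λ y → 𝟙 (y ≼ᵇ A) * G y) ≡ ∑Subset k (G ∘ φ)
    ∑-below G = begin
      sum (λ y → 𝟙 (y ≼ᵇ A) * G y)                           ≡⟨ sum-cong-≗ preimage ⟩
      sum (λ y → ∑Subset k (λ T → 𝟙 (φ T ≡ᵇ y) * G y))       ≡⟨ sum-∑Subset k (λ y T → 𝟙 (φ T ≡ᵇ y) * G y) ⟩
      ∑Subset k (λ T → sum (λ y → 𝟙 (φ T ≡ᵇ y) * G y))       ≡⟨ ∑Subset-cong k (λ T → sum-δ (φ T) G) ⟩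
      ∑Subset k (G ∘ φ)                                         ∎
      where
      open ≡-Reasoning
      preimage : ∀ y → 𝟙 (y ≼ᵇ A) * G y ≡ ∑Subset k (λ T → 𝟙 (φ T ≡ᵇ y) * G y)
      preimage y with y ≤? A
      ... | no y⋠A = sym (∑Subset-zero k (λ T → cong (λ b → 𝟙 b * G y)
                                                     (dec-false (φ T FinP.≟ y) (λ φT≡y → y⋠A (subst (_≼ A) φT≡y (φ≼A T))))))
      ... | yes y≼A with φ-onto y y≼A
      ...   | T₀ , refl = begin
        + 1 * G (φ T₀)                                          ≡⟨ ℤP.*-identityˡ _ ⟩
        G (φ T₀)                                                ≡⟨ sym (∑Subset-δ k T₀ (λ _ → G (φ T₀))) ⟩
        ∑Subset k (λ T → 𝟙 (does (T ≟ˢ T₀)) * G (φ T₀))         ≡⟨ ∑Subset-cong k (λ T → cong (λ b → 𝟙 b * G (φ T₀)) (sym (φ-≡ᵇ T T₀))) ⟩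
        ∑Subset k (λ T → 𝟙 (φ T ≡ᵇ φ T₀) * G (φ T₀))            ∎

    chains-suc-φ : ∀ j S → chains (suc j) (φ S) A ≡
      ∑Subset k (λ T → 𝟙 (does (S ⊆? T) ∧ not (does (S ≟ˢ T))) * chains j (φ T) A)
    chains-suc-φ j S = begin
      sum (λ y → 𝟙 (φ S ≺ᵇ y) * chains j y A)
        ≡⟨ sum-cong-≗ below-A ⟩
      sum (λ y → 𝟙 (y ≼ᵇ A) * (𝟙 (φ S ≺ᵇ y) * chains j y A))
        ≡⟨ ∑-below (λ y → 𝟙 (φ S ≺ᵇ y) * chains j y A) ⟩
      ∑Subset k (λ T → 𝟙 (φ S ≺ᵇ φ T) * chains j (φ T) A)
        ≡⟨ ∑Subset-cong k (λ T → cong (λ b → 𝟙 b * chains j (φ T) A) (φ-≺ᵇ S T)) ⟩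
      ∑Subset k (λ T → 𝟙 (does (S ⊆? T) ∧ not (does (S ≟ˢ T))) * chains j (φ T) A) ∎
      where
      open ≡-Reasoning
      below-A : ∀ y → 𝟙 (φ S ≺ᵇ y) * chains j y A ≡ 𝟙 (y ≼ᵇ A) * (𝟙 (φ S ≺ᵇ y) * chains j y A)
      below-A y with y ≤? A
      ... | yes _ = sym (ℤP.*-identityˡ _)
      ... | no y⋠A = trans (cong (𝟙 (φ S ≺ᵇ y) *_) (chains-outside A j y y⋠A))
                           (trans (ℤP.*-zeroʳ (𝟙 (φ S ≺ᵇ y))) (sym (ℤP.*-zeroˡ (𝟙 (φ S ≺ᵇ y) * chains j y A))))

    chains-φ : ∀ j S → chains j (φ S) A ≡ surj (corank S) j
    chains-φ zero S = begin
      𝟙 (φ S ≡ᵇ A)               ≡⟨ cong (λ B → 𝟙 (φ S ≡ᵇ B)) (sym φ⊤≡A) ⟩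
      𝟙 (φ S ≡ᵇ φ ⊤)             ≡⟨ cong 𝟙 (φ-≡ᵇ S ⊤) ⟩
      𝟙 (does (S ≟ˢ ⊤))          ≡⟨ sym (surj-corank-zero S) ⟩
      surj (corank S) 0          ∎
      where open ≡-Reasoning
    chains-φ (suc j) S = ∙-cancelʳ (surj z j) (chains (suc j) (φ S) A) (surj z (suc j)) (begin
      chains (suc j) (φ S) A + surj z j
        ≡⟨ cong₂ _+_ (chains-suc-φ j S) (sym (∑Subset-δ k S s)) ⟩
      ∑Subset k (λ T → strict T * chains j (φ T) A) + ∑Subset k (λ T → equal T * s T)
        ≡⟨ cong (_+ ∑Subset k (λ T → equal T * s T)) (∑Subset-cong k (λ T → cong (strict T *_) (chains-φ j T))) ⟩
      ∑Subset k (λ T → strict T * s T) + ∑Subset k (λ T → equal T * s T)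
        ≡⟨ sym (∑Subset-+ k (λ T → strict T * s T) (λ T → equal T * s T)) ⟩
      ∑Subset k (λ T → strict T * s T + equal T * s T)
        ≡⟨ ∑Subset-cong k (λ T → trans (sym (ℤP.*-distribʳ-+ (s T) (strict T) (equal T)))
                                        (cong (_* s T) (sym (𝟙-⊆?-split S T)))) ⟩
      ∑Subset k (λ T → 𝟙 (does (S ⊆? T)) * s T)
        ≡⟨ ∑-supersets k S (λ p → surj p j) ⟩
      ∑ (suc z) (λ p → binom z p * surj p j)
        ≡⟨ ∑-binom-surj z j ⟩
      surj z j + surj z (suc j)
        ≡⟨ ℤP.+-comm (surj z j) (surj z (suc j)) ⟩
      surj z (suc j) + surj z j ∎)
      where
      open ≡-Reasoning
      z = corank S
      strict equal s : Subset k → ℤ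
      strict T = 𝟙 (does (S ⊆? T) ∧ not (does (S ≟ˢ T)))
      equal T = 𝟙 (does (T ≟ˢ S))
      s T = surj (corank T) j

    φ-≡ᵇ-bot : ∀ U → φ U ≡ᵇ bot ≡ does (U ≟ˢ ⊥)
    φ-≡ᵇ-bot U = trans (cong (φ U ≡ᵇ_) (sym φ⊥≡bot)) (φ-≡ᵇ U ⊥)

    nonemptyᵇ-φ : ∀ T → nonemptyᵇ (φ T) ≡ not (does (T ≟ˢ ⊥))
    nonemptyᵇ-φ T = cong not (φ-≡ᵇ-bot T)

    atomᵇ-φ : ∀ T → atomᵇ (φ T) ≡ singletonᵇ T
    atomᵇ-φ T = BoolP.⇔→≡ {z = true} (mk⇔ atom⇒singleton singleton⇒atom)
      where
      minimal : Fin n → Bool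
      minimal C = not (C ≼ᵇ φ T) ∨ (C ≡ᵇ bot) ∨ (C ≡ᵇ φ T)
      minimal-φ : ∀ U → minimal (φ U) ≡ minimalOver T U
      minimal-φ U = cong₂ (λ a b → not a ∨ b) (φ-≼ᵇ U T) (cong₂ _∨_ (φ-≡ᵇ-bot U) (φ-≡ᵇ U T))
      all-minimal : L.foldr _∧_ true (L.map minimal (L.allFin n)) ≡ and (L.tabulate minimal)
      all-minimal = cong and (map-tabulate (λ x → x) minimal)
      atom⇒singleton : atomᵇ (φ T) ≡ true → singletonᵇ T ≡ true
      atom⇒singleton atom = atom⇒singletonᵇ T
        (trans (sym (nonemptyᵇ-φ T)) (BoolP.∧-conicalˡ _ _ atom))
        (λ U → trans (sym (minimal-φ U))
                     (and-tabulate⁻ n minimal (trans (sym all-minimal) (BoolP.∧-conicalʳ _ _ atom)) (φ U)))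
      singleton⇒atom : singletonᵇ T ≡ true → atomᵇ (φ T) ≡ true
      singleton⇒atom singleton =
        cong₂ _∧_ (trans (nonemptyᵇ-φ T) (proj₁ (singletonᵇ⇒atom T singleton)))
                  (trans all-minimal (and-tabulate⁺ n minimal minimal-true))
        where
        minimal-true : ∀ C → minimal C ≡ true
        minimal-true C with C ≤? φ T
        ... | no _ = refl
        ... | yes C≼φT with φ-onto C (≼-trans C≼φT (φ≼A T))
        ...   | U , refl = begin
          (φ U ≡ᵇ bot) ∨ (φ U ≡ᵇ φ T)                              ≡⟨ cong₂ _∨_ (φ-≡ᵇ-bot U) (φ-≡ᵇ U T) ⟩
          does (U ≟ˢ ⊥) ∨ does (U ≟ˢ T)                            ≡⟨ cong (λ b → not b ∨ does (U ≟ˢ ⊥) ∨ does (U ≟ˢ T)) (sym U⊆?T) ⟩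
          minimalOver T U                                          ≡⟨ proj₂ (singletonᵇ⇒atom T singleton) U ⟩
          true                                                     ∎
          where
          open ≡-Reasoning
          U⊆?T : does (U ⊆? T) ≡ true
          U⊆?T = dec-true (U ⊆? T) (Equivalence.from (φ-order U T) C≼φT)

    rank≡k : rank A ≡ k
    rank≡k = ℤP.+-injective (begin
      + rank A                                          ≡⟨ length-filterᵇ (λ B → atomᵇ B ∧ (B ≼ᵇ A)) (L.allFin n) ⟩
      ∑List (L.allFin n) (λ B → 𝟙 (atomᵇ B ∧ (B ≼ᵇ A)))  ≡⟨ ∑List-tabulate n (λ x → x) (λ B → 𝟙 (atomᵇ B ∧ (B ≼ᵇ A))) ⟩
      sum (λ B → 𝟙 (atomᵇ B ∧ (B ≼ᵇ A)))              ≡⟨ sum-cong-≗ (λ B → trans (𝟙-∧ (atomᵇ B) (B ≼ᵇ A)) (ℤP.*-comm (𝟙 (atomᵇ B)) _)) ⟩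
      sum (λ B → 𝟙 (B ≼ᵇ A) * 𝟙 (atomᵇ B))            ≡⟨ ∑-below (𝟙 ∘ atomᵇ) ⟩
      ∑Subset k (𝟙 ∘ atomᵇ ∘ φ)                         ≡⟨ ∑Subset-cong k (cong 𝟙 ∘ atomᵇ-φ) ⟩
      ∑Subset k (𝟙 ∘ singletonᵇ)                        ≡⟨ ∑Subset-singletonᵇ k ⟩
      + k                                               ∎)
      where open ≡-Reasoning

    chains-bot : ∀ j → chains j bot A ≡ surj (rank A) j
    chains-bot j = begin
      chains j bot A          ≡⟨ cong (λ B → chains j B A) (sym φ⊥≡bot) ⟩
      chains j (φ ⊥) A        ≡⟨ chains-φ j ⊥ ⟩
      surj (corank (⊥ {k})) j ≡⟨ cong (λ r → surj r j) (trans (corank-⊥ k) (sym rank≡k)) ⟩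
      surj (rank A) j         ∎
      where open ≡-Reasoning

  chains-bot≡surj-rank : ∀ A j → chains j bot A ≡ surj (rank A) j
  chains-bot≡surj-rank A j with boolean A
  ... | k , φ , φ≼A , φ-onto , φ-order = BooleanInterval.chains-bot A φ φ≼A φ-onto φ-order j

  fsd≡surjTransform : ∀ d → HasDim Δ d → ∀ j → + fsd Δ j ≡ surjTransform d (+_ ∘ f Δ) j
  fsd≡surjTransform d (rank≤d , _) j = begin
    + fsd Δ j
      ≡⟨ fsd≡∑chains j ⟩
    sum (λ A → chains j bot A)
      ≡⟨ sum-cong-≗ (λ A → trans (chains-bot≡surj-rank A j) (sym (∑-δ (suc d) (rank A) (λ r → surj r j) (s≤s (rank≤d A))))) ⟩
    sum (λ A → ∑ (suc d) (λ r → 𝟙 (does (rank A ℕ.≟ r)) * surj r j))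
      ≡⟨ ∑-comm {n} {suc d} (λ A r → 𝟙 (does (rank A ℕ.≟ toℕ r)) * surj (toℕ r) j) ⟩
    ∑ (suc d) (λ r → sum (λ A → 𝟙 (does (rank A ℕ.≟ r)) * surj r j))
      ≡⟨ ∑-cong (suc d) (λ r _ → count-rank r) ⟩
    surjTransform d (+_ ∘ f Δ) j ∎
    where
    open ≡-Reasoning
    count-rank : ∀ r → sum (λ A → 𝟙 (does (rank A ℕ.≟ r)) * surj r j) ≡ + f Δ r * surj r j
    count-rank r = begin
      sum (λ A → 𝟙 (does (rank A ℕ.≟ r)) * surj r j)  ≡⟨ *-distribʳ-sum {n} (surj r j) _ ⟨
      sum (λ A → 𝟙 (does (rank A ℕ.≟ r))) * surj r j  ≡⟨ cong (_* surj r j) faces-of-rank ⟨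
      + f Δ r * surj r j                              ∎
      where
      faces-of-rank : + f Δ r ≡ sum (λ A → 𝟙 (does (rank A ℕ.≟ r)))
      faces-of-rank = trans (length-filterᵇ _ (L.allFin n)) (∑List-tabulate n (λ x → x) _)

corollary2p6 : (Δ : BooleanCellComplex) (d : ℕ) → HasDim Δ d →
    Reciprocal d (hVec d (f Δ)) → Reciprocal d (hVec d (fsd Δ))
corollary2p6 Δ d hasDim = reciprocal-surjTransform d (f Δ) (fsd Δ) (λ j _ → fsd≡surjTransform Δ d hasDim j)
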